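{- Let $P$ be a primed decomposition tableau and let $(a,b)$ be the first box, in the reverse row reading order, with $P_{ab}\in\{1',1\}$; write $P_{ab}=1^\circ$. Let $x=2^\bullet\in\{2',2\}$ and $\tilde x=1^\circ$, and form $\tilde P$ from $P$ by replacing $P_{ab}$ by $1^\bullet$ (the number $1$ primed if and only if $x$ is primed). Then $e_{\overline1}(x\xrightarrow{\mathsf{dec}}P)=\tilde x\xrightarrow{\mathsf{dec}}\tilde P$, and the insertions $x\xrightarrow{\mathsf{dec}}P$ and $\tilde x\xrightarrow{\mathsf{dec}}\tilde P$ are both even or both odd.
   Context: Primed numbers: $i':=i-\tfrac12$, ordered $1'<1<2'<2<\cdots$; subtracting 1 keeps prime status; $\lceil\cdot\rceil$ removes a prime. $e_{\overline1}$ on a word $w=w_1\cdots w_m$: let $j,k$ be minimal with $w_j\in\{2',2\}$, $w_k\in\{1',1\}$; if $j$ does not exist or $j>k$ then $0$; if $j$ exists and $k$ does not, subtract 1 from $w_j$; otherwise replace $w_j$ by $w_k$ and $w_k$ by $w_j-1$. For strict $\lambda$ the shifted diagram is $\{(i,i+j-1):i\in[\ell(\lambda)],j\in[\lambda_i]\}$; row $i$ = boxes $(i,\cdot)$. $\mathsf{revrow}(T)$ reads row 1 right to left, then row 2 right to left, etc. (the reverse row reading order of boxes). For a shifted tableau $T$, $e_{\overline1}(T)$ is $0$ if $e_{\overline1}(\mathsf{revrow}(T))=0$ and otherwise the tableau of the same shape whose reverse row reading word is $e_{\overline1}(\mathsf{revrow}(T))$. A hook word is a sequence of positive integers $w_1\cdots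 w_k$ with $w_1\ge\dots\ge w_p<w_{p+1}<\dots<w_k$ for some $p\in[k]$; $w_1\cdots w_p$ is its weakly decreasing part, $w_{p+1}\cdots w_k$ its increasing part, $w_p$ its middle element. A decomposition tableau assigns positive integers so that each row $\rho_i$ (left to right) is a hook word and $\rho_i$ is a hook subword of maximal length in $\rho_{i+1}\rho_i$; a primed decomposition tableau adds primes to the middle elements of some subset of rows. Decomposition insertion $y\xrightarrow{\mathsf{dec}}T$ of a primed number $y$: at step $i$ a primed number $a_i$ is inserted into row $i$ (possibly empty), starting with $a_1=y$. Put $a=\lceil a_i\rceil$ and remove any prime from the middle element $m_i$ of row $i$ (if nonempty), remembering whether it was primed. If appending $a$ to the row gives a hook word, append it; otherwise $a$ replaces the leftmost entry $b$ of the increasing part with $b\ge a$, and $b$ replaces the leftmost entry $c$ of the weakly decreasing part with $c<b$. Then (1) if row $i$ was empty or the middle position changed: if $a_i$ is primed, prime the new middle element; if a box was appended, halt, the insertion being even if row $i$ was empty or $m_i$ unprimed, odd otherwise; else $a_{i+1}=c$ if $m_i$ was unprimed, $c'$ if primed. (2) Otherwise: if $m_i$ was primed, prime the middle element; if a box was appended, halt, the insertion being even if $a_i$ is unprimed, odd if primed; else $a_{i+1}=c$ if $a_i$ is unprimed, $c'$ if primed. -}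

module Defs where

open import Data.Nat using (ℕ; zero; suc; _∸_; _≤_; _<_; _≤ᵇ_; _<ᵇ_; _≡ᵇ_)
open import Data.Bool using (Bool; true; false; if_then_else_; _∧_; not)
open import Data.List using (List; []; _∷_; _++_; [_]; length; reverse; take; drop; map)
open import Data.List.Relation.Binary.Sublist.Propositional using (_⊆_)
open import Data.Maybe using (Maybe; just; nothing; _>>=_)
open import Data.Product using (Σ; ∃; _×_; _,_; proj₁)
open import Relation.Binary.PropositionalEquality using (_≡_)

-- Primed numbers.  (val , true) is the primed number  val' = val - 1/2,
-- (val , false) is the unprimed number val.  ⌈_⌉ = val removes the prime.
-- Subtracting 1 keeps the prime status.

record PN : Set where
  constructor _^_
  field
    val    : ℕ
    primed : Bool
open PN public

⌈_⌉ : PN → ℕ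
⌈ x ⌉ = val x

minus1 : PN → PN
minus1 (n ^ b) = (n ∸ 1) ^ b

nth : {A : Set} → List A → ℕ → Maybe A
nth []       _       = nothing
nth (x ∷ xs) zero    = just x
nth (x ∷ xs) (suc i) = nth xs i

modifyAt : {A : Set} → ℕ → (A → A) → List A → List A
modifyAt _       f []       = []
modifyAt zero    f (x ∷ xs) = f x ∷ xs
modifyAt (suc i) f (x ∷ xs) = x ∷ modifyAt i f xs

firstIdx : {A : Set} → (A → Bool) → List A → Maybe ℕ
firstIdx p [] = nothing
firstIdx p (x ∷ xs) = if p x then just zero else (firstIdx p xs >>= λ i → just (suc i))

replaceFirst : (ℕ → Bool) → ℕ → List ℕ → Maybe (ℕ × List ℕ)
replaceFirst p z [] = nothing
replaceFirst p z (y ∷ ys) =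
  if p y then just (y , z ∷ ys)
  else (replaceFirst p z ys >>= λ where (w , ys′) → just (w , y ∷ ys′))

-- A hook word is a sequence of positive integers
-- w₁ ⋯ w_k with w₁ ≥ ⋯ ≥ w_p < w_{p+1} < ⋯ < w_k for some p ∈ [k].
-- Such p is unique (it is the first ascent, or k), so we compute it.
-- hookSplit w = just (d , m , v) iff w is a hook word with
--   w = d ++ [ m ] ++ v,  d ++ [ m ] its weakly decreasing part,
--   m = w_p its middle element, v its increasing part.

strictInc : List ℕ → Bool
strictInc []           = true
strictInc (x ∷ [])     = true
strictInc (x ∷ y ∷ ys) = (x <ᵇ y) ∧ strictInc (y ∷ ys)

private
  split : List ℕ → ℕ → List ℕ → Maybe (List ℕ × ℕ × List ℕ)
  split acc m [] = just (reverse acc , m , [])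
  split acc m (y ∷ ys) =
    if y ≤ᵇ m then split (m ∷ acc) y ys
    else (if strictInc (m ∷ y ∷ ys) then just (reverse acc , m , y ∷ ys) else nothing)

allPos : List ℕ → Bool
allPos []       = true
allPos (n ∷ ns) = (1 ≤ᵇ n) ∧ allPos ns

hookSplit : List ℕ → Maybe (List ℕ × ℕ × List ℕ)
hookSplit [] = nothing
hookSplit (x ∷ xs) =
  if allPos (x ∷ xs) then split [] x xs else nothing

IsHook : List ℕ → Set
IsHook w = ∃ λ t → hookSplit w ≡ just t

-- Shifted tableaux: list of rows (row 1 first), each row read left to
-- right; row i occupies boxes (i,i),…,(i,i+λᵢ-1).

Tab : Set
Tab = List (List PN)

StrictShape : Tab → Set
StrictShape []           = Data.Unit.⊤ where import Data.Unit
StrictShape (r ∷ [])     = 1 ≤ length r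
StrictShape (r ∷ s ∷ rs) = length s < length r × StrictShape (s ∷ rs)

revrow : {A : Set} → List (List A) → List A
revrow []       = []
revrow (r ∷ rs) = reverse r ++ revrow rs

refill : {A : Set} → List (List A) → List A → List (List A)
refill []       w = []
refill (r ∷ rs) w = reverse (take (length r) w) ∷ refill rs (drop (length r) w)

markAt : ℕ → Bool → List ℕ → List PN
markAt _       b []       = []
markAt zero    b (x ∷ xs) = (x ^ b) ∷ map (λ n → n ^ false) xs
markAt (suc i) b (x ∷ xs) = (x ^ false) ∷ markAt i b xs

MaxHook : List ℕ → List ℕ → Set
MaxHook σ ρ = IsHook ρ × (∀ s → s ⊆ (σ ++ ρ) → IsHook s → length s ≤ length ρ)

DecRows : List (List ℕ) → Set
DecRows []           = Data.Unit.⊤ where import Data.Unit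
DecRows (ρ ∷ [])     = MaxHook [] ρ
DecRows (ρ ∷ σ ∷ ρs) = MaxHook σ ρ × DecRows (σ ∷ ρs)

PrimedRow : List PN → Set
PrimedRow r = Σ (List ℕ × ℕ × List ℕ) λ where
  (d , m , v) → hookSplit (map val r) ≡ just (d , m , v)
              × ∃ λ b → r ≡ markAt (length d) b (map val r)

AllRows : Tab → Set
AllRows []       = Data.Unit.⊤ where import Data.Unit
AllRows (r ∷ rs) = PrimedRow r × AllRows rs

IsPDT : Tab → Set
IsPDT P = StrictShape P × AllRows P × DecRows (map (map val) P)

data Parity : Set where
  even odd : Parity

data Step : Set where
  halt : List PN → Parity → Step
  bump : List PN → PN → Step
  fail : Step                            -- never happens on valid input

insRow : PN → List PN → Step
insRow ai r with hookSplit (map val r)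
... | nothing = fail
... | just (d , m , v) with nth r (length d)
...   | nothing = fail
...   | just mEntry = go (hookSplit (u ++ [ a ]))
  where
  a   = ⌈ ai ⌉
  u   = map val r
  mp  = primed mEntry
  oldMid = length d
  finish : Bool → List ℕ → Maybe ℕ → Step   -- appended? , new row, c
  finish app u′ mc with hookSplit u′
  ... | nothing = fail
  ... | just (d′ , _ , _) with oldMid ≡ᵇ length d′ | app | mc
  ...   | false | true  | _      = halt (markAt (length d′) (primed ai) u′) (if mp then odd else even)
  ...   | false | false | just c = bump (markAt (length d′) (primed ai) u′) (c ^ mp)
  ...   | true  | true  | _      = halt (markAt (length d′) mp u′) (if primed ai then odd else even)
  ...   | true  | false | just c = bump (markAt (length d′) mp u′) (c ^ primed ai)
  ...   | _     | false | nothing = fail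
  go : Maybe (List ℕ × ℕ × List ℕ) → Step
  go (just _) = finish true (u ++ [ a ]) nothing
  go nothing with replaceFirst (λ b → a ≤ᵇ b) a v
  ... | nothing = fail
  ... | just (b , v′) with replaceFirst (λ c → c <ᵇ b) b (d ++ [ m ])
  ...   | nothing = fail
  ...   | just (c , dm′) = finish false (dm′ ++ v′) (just c)

decIns : PN → Tab → Maybe (Tab × Parity)
decIns y [] = just ([ [ ⌈ y ⌉ ^ primed y ] ] , even)
decIns y ([] ∷ rs) = just ([ ⌈ y ⌉ ^ primed y ] ∷ rs , even)
decIns y ((x ∷ r) ∷ rs) with insRow y (x ∷ r)
... | halt r′ π  = just ((r′ ∷ rs) , π)
... | bump r′ y′ = decIns y′ rs >>= λ where (T , π) → just ((r′ ∷ T) , π)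
... | fail       = nothing

is2 is1 : PN → Bool
is2 y = val y ≡ᵇ 2
is1 y = val y ≡ᵇ 1

-- nothing represents 0
e1w : List PN → Maybe (List PN)
e1w w with firstIdx is2 w | firstIdx is1 w
... | nothing | _       = nothing
... | just j  | nothing = just (modifyAt j minus1 w)
... | just j  | just k with k <ᵇ j | nth w j | nth w k
...   | true  | _       | _       = nothing
...   | false | just wj | just wk = just (modifyAt k (λ _ → minus1 wj) (modifyAt j (λ _ → wk) w))
...   | false | _       | _       = nothing

e1T : Tab → Maybe Tab
e1T T = e1w (revrow T) >>= λ w → just (refill T w)

{-# OPTIONS --safe #-}
-- Read right to left, a row lists its increasing part, its middle element and its weakly
-- decreasing part, and the middle element is the smallest entry of the row. Hence the first 1
-- of the reading word is the middle element 1° of some row, and all rows above it have entries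
-- ≥ 2. In those rows x = 2• and x̃ = 1° follow the same bumping path and settle in the same
-- place, so the two results differ only there; the entry c ≥ 2 passed on towards the row of 1°
-- meets rows that differ only in the prime of that 1, and behaves identically in both (when it
-- bumps the 1 itself, the 1 carries its own prime further down). If 1° lies in the row where x
-- and x̃ are inserted, the same holds except that x may land right before the middle 1. In all
-- cases the parities agree, and the reading words differ exactly by e₁: the first 2 becomes the
-- first 1, and that 1 becomes 2 − 1 with the prime of x.
module Submission where

open import Defs
open import Data.Bool using (Bool; true; false; if_then_else_; _∧_; T)
open import Data.Bool.Properties using (∧-identityʳ; ∧-zeroʳ)
open import Data.Empty using (⊥; ⊥-elim)
open import Data.List using (List; []; _∷_; _++_; [_]; _∷ʳ_; length; reverse; take; drop; map; initLast; _∷ʳ′_)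
open import Data.List.Properties
open import Data.List.Relation.Unary.All as All using (All; []; _∷_)
open import Data.List.Relation.Unary.All.Properties using (++⁺; ++⁻; ++⁻ˡ; ++⁻ʳ; map⁺)
open import Data.List.Relation.Unary.Any using (Any; here; there)
open import Data.Maybe using (Maybe; just; nothing; _>>=_)
open import Data.Nat using (ℕ; zero; suc; _+_; _≤_; _<_; z≤n; s≤s; _≤ᵇ_; _<ᵇ_; _≡ᵇ_; _≟_; _<?_)
open import Data.Nat.Properties
open import Data.Product using (Σ; _×_; _,_; proj₁; proj₂)
open import Data.Sum using (_⊎_; inj₁; inj₂)
open import Data.Unit using (⊤; tt)
open import Function.Base using (_∘_; _∋_)
open import Relation.Binary.PropositionalEquality hiding ([_])
open import Relation.Nullary using (¬_; yes; no; contradiction)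

T⇒≡true : ∀ {b} → T b → b ≡ true
T⇒≡true {true} _ = refl

≡true⇒T : ∀ {b} → b ≡ true → T b
≡true⇒T refl = tt

≤⇒≤ᵇ≡true : ∀ {m n} → m ≤ n → (m ≤ᵇ n) ≡ true
≤⇒≤ᵇ≡true p = T⇒≡true (≤⇒≤ᵇ p)

<⇒<ᵇ≡true : ∀ {m n} → m < n → (m <ᵇ n) ≡ true
<⇒<ᵇ≡true p = T⇒≡true (<⇒<ᵇ p)

≤ᵇ≡true⇒≤ : ∀ {m n} → (m ≤ᵇ n) ≡ true → m ≤ n
≤ᵇ≡true⇒≤ {m} {n} e = ≤ᵇ⇒≤ m n (≡true⇒T e)

<ᵇ≡true⇒< : ∀ {m n} → (m <ᵇ n) ≡ true → m < n
<ᵇ≡true⇒< {m} {n} e = <ᵇ⇒< m n (≡true⇒T e)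

>⇒≤ᵇ≡false : ∀ {m n} → n < m → (m ≤ᵇ n) ≡ false
>⇒≤ᵇ≡false {m} {n} p with m ≤ᵇ n in eq
... | false = refl
... | true  = ⊥-elim (<⇒≱ p (≤ᵇ≡true⇒≤ eq))

≥⇒<ᵇ≡false : ∀ {m n} → n ≤ m → (m <ᵇ n) ≡ false
≥⇒<ᵇ≡false {m} {n} p with m <ᵇ n in eq
... | false = refl
... | true  = ⊥-elim (<⇒≱ (<ᵇ≡true⇒< eq) p)

≤ᵇ≡false⇒> : ∀ {m n} → (m ≤ᵇ n) ≡ false → n < m
≤ᵇ≡false⇒> e = ≰⇒> λ m≤n → contradiction (trans (sym e) (≤⇒≤ᵇ≡true m≤n)) λ ()

<ᵇ≡false⇒≥ : ∀ {m n} → (m <ᵇ n) ≡ false → n ≤ m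
<ᵇ≡false⇒≥ e = ≮⇒≥ λ m<n → contradiction (trans (sym e) (<⇒<ᵇ≡true m<n)) λ ()

∧≡true : ∀ {a b} → (a ∧ b) ≡ true → a ≡ true × b ≡ true
∧≡true {true} e = refl , e

≡⇒≡ᵇ≡true : ∀ {m n} → m ≡ n → (m ≡ᵇ n) ≡ true
≡⇒≡ᵇ≡true {m} {n} e = T⇒≡true (≡⇒≡ᵇ m n e)

≢⇒≡ᵇ≡false : ∀ {m n} → m ≢ n → (m ≡ᵇ n) ≡ false
≢⇒≡ᵇ≡false {m} {n} m≢n with m ≡ᵇ n in eq
... | false = refl
... | true  = ⊥-elim (m≢n (≡ᵇ⇒≡ m n (≡true⇒T eq)))

WeaklyDecreasing : List ℕ → Set
WeaklyDecreasing []           = ⊤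
WeaklyDecreasing (x ∷ [])     = ⊤
WeaklyDecreasing (x ∷ y ∷ ys) = y ≤ x × WeaklyDecreasing (y ∷ ys)

Increasing : List ℕ → Set
Increasing []           = ⊤
Increasing (x ∷ [])     = ⊤
Increasing (x ∷ y ∷ ys) = x < y × Increasing (y ∷ ys)

Positive : List ℕ → Set
Positive = All (1 ≤_)

strictInc-complete : ∀ l → Increasing l → strictInc l ≡ true
strictInc-complete []           _       = refl
strictInc-complete (x ∷ [])     _       = refl
strictInc-complete (x ∷ y ∷ ys) (p , q) = cong₂ _∧_ (<⇒<ᵇ≡true p) (strictInc-complete (y ∷ ys) q)

strictInc-sound : ∀ l → strictInc l ≡ true → Increasing l
strictInc-sound []           _ = tt
strictInc-sound (x ∷ [])     _ = tt
strictInc-sound (x ∷ y ∷ ys) e =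
  <ᵇ≡true⇒< (proj₁ (∧≡true e)) , strictInc-sound (y ∷ ys) (proj₂ (∧≡true e))

allPos-complete : ∀ l → Positive l → allPos l ≡ true
allPos-complete []      []       = refl
allPos-complete (x ∷ l) (p ∷ ps) = cong₂ _∧_ (≤⇒≤ᵇ≡true p) (allPos-complete l ps)

allPos-sound : ∀ l → allPos l ≡ true → Positive l
allPos-sound []      _ = []
allPos-sound (x ∷ l) e = ≤ᵇ≡true⇒≤ (proj₁ (∧≡true e)) ∷ allPos-sound l (proj₂ (∧≡true e))

WeaklyDecreasing-tail : ∀ {x} l → WeaklyDecreasing (x ∷ l) → WeaklyDecreasing l
WeaklyDecreasing-tail []      _       = tt
WeaklyDecreasing-tail (y ∷ l) (_ , w) = w

Increasing-tail : ∀ {x} l → Increasing (x ∷ l) → Increasing l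
Increasing-tail []      _       = tt
Increasing-tail (y ∷ l) (_ , s) = s

WeaklyDecreasing-∷ʳ : ∀ l x y → WeaklyDecreasing (l ++ [ x ]) → y ≤ x → WeaklyDecreasing ((l ++ [ x ]) ++ [ y ])
WeaklyDecreasing-∷ʳ []          x y w       p = p , tt
WeaklyDecreasing-∷ʳ (a ∷ [])    x y (q , w) p = q , p , tt
WeaklyDecreasing-∷ʳ (a ∷ b ∷ l) x y (q , w) p = q , WeaklyDecreasing-∷ʳ (b ∷ l) x y w p

All-middle : ∀ {Q : ℕ → Set} l₁ c l₂ → All Q (l₁ ++ c ∷ l₂) → Q c
All-middle l₁ c l₂ al = All.head (++⁻ʳ l₁ al)

All-replace : ∀ {Q : ℕ → Set} l₁ c l₂ z → All Q (l₁ ++ c ∷ l₂) → Q z → All Q (l₁ ++ z ∷ l₂)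
All-replace l₁ c l₂ z al qz = ++⁺ (++⁻ˡ l₁ al) (qz ∷ All.tail (++⁻ʳ l₁ al))

All-∷-split : ∀ {Q : ℕ → Set} d m v → All Q (d ++ m ∷ v) → All Q (d ++ [ m ]) × All Q v
All-∷-split d m v al = ++⁻ (d ++ [ m ]) (subst (All _) (sym (++-assoc d [ m ] v)) al)

All-reverse : ∀ {A : Set} {Q : A → Set} l → All Q l → All Q (reverse l)
All-reverse []      []       = []
All-reverse (x ∷ l) (q ∷ al) rewrite unfold-reverse x l = ++⁺ (All-reverse l al) (q ∷ [])

Any-∷ʳ : ∀ {P : ℕ → Set} l x → P x → Any P (l ++ [ x ])
Any-∷ʳ []      x px = here px
Any-∷ʳ (y ∷ l) x px = there (Any-∷ʳ l x px)

WeaklyDecreasing⇒All≥last : ∀ d m → WeaklyDecreasing (d ++ [ m ]) → All (m ≤_) (d ++ [ m ])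
WeaklyDecreasing⇒All≥last []      m _ = ≤-refl ∷ []
WeaklyDecreasing⇒All≥last (x ∷ d) m w with WeaklyDecreasing⇒All≥last d m (WeaklyDecreasing-tail (d ++ [ m ]) w)
WeaklyDecreasing⇒All≥last (x ∷ [])    m (p , _) | rest       = p ∷ rest
WeaklyDecreasing⇒All≥last (x ∷ y ∷ d) m (p , _) | (q ∷ rest) = ≤-trans q p ∷ q ∷ rest

Increasing⇒All>head : ∀ m v → Increasing (m ∷ v) → All (m <_) v
Increasing⇒All>head m []       _       = []
Increasing⇒All>head m (y ∷ ys) (p , s) = p ∷ All.map (<-trans p) (Increasing⇒All>head y ys s)

Increasing-lowerHead : ∀ {x y} ys → x ≤ y → Increasing (y ∷ ys) → Increasing (x ∷ ys)
Increasing-lowerHead []       _   _       = tt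
Increasing-lowerHead (z ∷ ys) x≤y (p , s) = ≤-<-trans x≤y p , s

Increasing-∷ : ∀ {x} l → Increasing l → All (x <_) l → Increasing (x ∷ l)
Increasing-∷ []      _ _       = tt
Increasing-∷ (y ∷ l) s (p ∷ _) = p , s

WeaklyDecreasing-∷ʳ-All : ∀ l x → WeaklyDecreasing l → All (x ≤_) l → WeaklyDecreasing (l ++ [ x ])
WeaklyDecreasing-∷ʳ-All []          x _       _        = tt
WeaklyDecreasing-∷ʳ-All (y ∷ [])    x _       (p ∷ _)  = p , tt
WeaklyDecreasing-∷ʳ-All (y ∷ z ∷ l) x (q , w) (p ∷ al) = q , WeaklyDecreasing-∷ʳ-All (z ∷ l) x w al

WeaklyDecreasing-replace : ∀ l₁ c l₂ b → WeaklyDecreasing (l₁ ++ c ∷ l₂) → All (λ x → (x <ᵇ b) ≡ false) l₁ → c ≤ b →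
  WeaklyDecreasing (l₁ ++ b ∷ l₂)
WeaklyDecreasing-replace []          c []       b w       _        c≤b = tt
WeaklyDecreasing-replace []          c (y ∷ l₂) b (p , w) _        c≤b = ≤-trans p c≤b , w
WeaklyDecreasing-replace (x ∷ [])    c l₂       b (p , w) (q ∷ _)  c≤b = <ᵇ≡false⇒≥ q , WeaklyDecreasing-replace [] c l₂ b w [] c≤b
WeaklyDecreasing-replace (x ∷ y ∷ l₁) c l₂      b (p , w) (q ∷ al) c≤b = p , WeaklyDecreasing-replace (y ∷ l₁) c l₂ b w al c≤b

Increasing-replace : ∀ l₁ b l₂ a → Increasing (l₁ ++ b ∷ l₂) → All (λ x → (a ≤ᵇ x) ≡ false) l₁ → a ≤ b →
  Increasing (l₁ ++ a ∷ l₂)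
Increasing-replace []          b []       a s       _        a≤b = tt
Increasing-replace []          b (y ∷ l₂) a (p , s) _        a≤b = ≤-<-trans a≤b p , s
Increasing-replace (x ∷ [])    b l₂       a (p , s) (q ∷ _)  a≤b = ≤ᵇ≡false⇒> q , Increasing-replace [] b l₂ a s [] a≤b
Increasing-replace (x ∷ y ∷ l₁) b l₂      a (p , s) (q ∷ al) a≤b = p , Increasing-replace (y ∷ l₁) b l₂ a s al a≤b

length-++-cong : ∀ {A : Set} (l : List A) xs ys → length xs ≡ length ys → length (l ++ xs) ≡ length (l ++ ys)
length-++-cong l xs ys eq = trans (length-++ l) (trans (cong (length l +_) eq) (sym (length-++ l)))

length-replace : ∀ {A : Set} (l₁ : List A) x z l₂ → length (l₁ ++ x ∷ l₂) ≡ length (l₁ ++ z ∷ l₂)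
length-replace l₁ x z l₂ = length-++-cong l₁ (x ∷ l₂) (z ∷ l₂) refl

length≢length-∷ʳ : ∀ {A : Set} (d : List A) x → length d ≢ length (d ++ [ x ])
length≢length-∷ʳ d x eq = 1+n≢n (sym (trans eq (trans (length-++ d) (+-comm (length d) 1))))

init-last : ∀ (x : ℕ) l → Σ (List ℕ × ℕ) λ where (i , z) → x ∷ l ≡ i ++ [ z ]
init-last x []      = ([] , x) , refl
init-last x (y ∷ l) with init-last y l
... | (i , z) , eq = (x ∷ i , z) , cong (x ∷_) eq

nonempty-∷ʳ : ∀ (l₁ : List ℕ) b l₂ → Σ (List ℕ × ℕ) λ where (i , z) → l₁ ++ b ∷ l₂ ≡ i ++ [ z ]
nonempty-∷ʳ []       b l₂ = init-last b l₂
nonempty-∷ʳ (x ∷ l₁) b l₂ = init-last x (l₁ ++ b ∷ l₂)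

∷ʳ-split : ∀ {A : Set} (d : List A) x l₁ c l₂ → d ++ [ x ] ≡ l₁ ++ c ∷ l₂ →
  (l₂ ≡ [] × d ≡ l₁ × c ≡ x) ⊎ Σ (List A) λ l₂′ → (l₂ ≡ l₂′ ++ [ x ]) × (d ≡ l₁ ++ c ∷ l₂′)
∷ʳ-split d x l₁ c l₂ eq with initLast l₂
∷ʳ-split d x l₁ c .[] eq | [] with ∷ʳ-injective d l₁ eq
... | refl , refl = inj₁ (refl , refl , refl)
∷ʳ-split d x l₁ c .(i ∷ʳ z) eq | i ∷ʳ′ z with ∷ʳ-injective d (l₁ ++ c ∷ i) (trans eq (sym (++-assoc l₁ (c ∷ i) [ z ])))
... | refl , refl = inj₂ (i , refl , refl)

-- Hook words

-- The accumulator-passing helper of hookSplit is private; the metavariable splitAcc is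
-- solved to it by unification once the initial accumulator [] is generalised.
mutual
  splitAcc : List ℕ → ℕ → List ℕ → Maybe (List ℕ × ℕ × List ℕ)
  splitAcc = _

  hookSplit-∷ : ∀ x xs → hookSplit (x ∷ xs) ≡ (if allPos (x ∷ xs) then splitAcc [] x xs else nothing)
  hookSplit-∷ x xs with allPos (x ∷ xs)
  ... | false = refl
  ... | true with List ℕ ∋ []
  ...   | acc = refl

splitAcc-atMiddle : ∀ acc m v → Increasing (m ∷ v) → splitAcc acc m v ≡ just (reverse acc , m , v)
splitAcc-atMiddle acc m []       _       = refl
splitAcc-atMiddle acc m (y ∷ ys) (p , q) rewrite >⇒≤ᵇ≡false p | strictInc-complete (m ∷ y ∷ ys) (p , q) = refl

splitAcc-complete : ∀ acc x d m v → WeaklyDecreasing (x ∷ d ++ [ m ]) → Increasing (m ∷ v) →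
                    splitAcc acc x (d ++ m ∷ v) ≡ just (reverse acc ++ x ∷ d , m , v)
splitAcc-complete acc x []      m v (p , _) s
  rewrite ≤⇒≤ᵇ≡true p | splitAcc-atMiddle (x ∷ acc) m v s | unfold-reverse x acc = refl
splitAcc-complete acc x (y ∷ d) m v (p , w) s
  rewrite ≤⇒≤ᵇ≡true p | splitAcc-complete (x ∷ acc) y d m v w s
        | unfold-reverse x acc | ++-assoc (reverse acc) [ x ] (y ∷ d) = refl

splitAcc-notHookAtMiddle : ∀ acc m y ys → m < y → strictInc (m ∷ y ∷ ys) ≡ false → splitAcc acc m (y ∷ ys) ≡ nothing
splitAcc-notHookAtMiddle acc m y ys q e rewrite >⇒≤ᵇ≡false q | e = refl

splitAcc-notHook : ∀ acc x d m y ys → WeaklyDecreasing (x ∷ d ++ [ m ]) → m < y → strictInc (m ∷ y ∷ ys) ≡ false →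
                   splitAcc acc x (d ++ m ∷ y ∷ ys) ≡ nothing
splitAcc-notHook acc x []      m y ys (p , _) q e rewrite ≤⇒≤ᵇ≡true p = splitAcc-notHookAtMiddle (x ∷ acc) m y ys q e
splitAcc-notHook acc x (z ∷ d) m y ys (p , w) q e rewrite ≤⇒≤ᵇ≡true p = splitAcc-notHook (x ∷ acc) z d m y ys w q e

splitAcc-sound : ∀ acc x xs d m v → WeaklyDecreasing (reverse acc ++ [ x ]) → splitAcc acc x xs ≡ just (d , m , v) →
                 (reverse acc ++ x ∷ xs ≡ d ++ m ∷ v) × WeaklyDecreasing (d ++ [ m ]) × Increasing (m ∷ v)
splitAcc-sound acc x []       d m v w refl = refl , w , tt
splitAcc-sound acc x (y ∷ ys) d m v w e with y ≤ᵇ x in y≤x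
... | true with splitAcc-sound (x ∷ acc) y ys d m v
                  (subst (λ z → WeaklyDecreasing (z ++ [ y ])) (sym (unfold-reverse x acc))
                         (WeaklyDecreasing-∷ʳ (reverse acc) x y w (≤ᵇ≡true⇒≤ y≤x))) e
...   | eq , w′ , s′ = trans reassoc eq , w′ , s′
  where
  reassoc : reverse acc ++ x ∷ y ∷ ys ≡ reverse (x ∷ acc) ++ y ∷ ys
  reassoc = sym (trans (cong (_++ y ∷ ys) (unfold-reverse x acc)) (++-assoc (reverse acc) [ x ] (y ∷ ys)))
splitAcc-sound acc x (y ∷ ys) d m v w e | false with strictInc (x ∷ y ∷ ys) in inc
splitAcc-sound acc x (y ∷ ys) d m v w refl | false | true = refl , w , strictInc-sound (x ∷ y ∷ ys) inc

hookSplit-complete : ∀ d m v → WeaklyDecreasing (d ++ [ m ]) → Increasing (m ∷ v) → Positive (d ++ m ∷ v) →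
                     hookSplit (d ++ m ∷ v) ≡ just (d , m , v)
hookSplit-complete []      m v w s ps rewrite hookSplit-∷ m v | allPos-complete (m ∷ v) ps = splitAcc-atMiddle [] m v s
hookSplit-complete (x ∷ d) m v w s ps
  rewrite hookSplit-∷ x (d ++ m ∷ v) | allPos-complete (x ∷ d ++ m ∷ v) ps = splitAcc-complete [] x d m v w s

hookSplit-notHook : ∀ d m y ys → WeaklyDecreasing (d ++ [ m ]) → m < y → strictInc (m ∷ y ∷ ys) ≡ false →
                    hookSplit (d ++ m ∷ y ∷ ys) ≡ nothing
hookSplit-notHook [] m y ys w q e rewrite hookSplit-∷ m (y ∷ ys) with allPos (m ∷ y ∷ ys)
... | true  = splitAcc-notHookAtMiddle [] m y ys q e
... | false = refl
hookSplit-notHook (x ∷ d) m y ys w q e rewrite hookSplit-∷ x (d ++ m ∷ y ∷ ys) with allPos (x ∷ d ++ m ∷ y ∷ ys)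
... | true  = splitAcc-notHook [] x d m y ys w q e
... | false = refl

hookSplit-sound : ∀ w d m v → hookSplit w ≡ just (d , m , v) →
                  (w ≡ d ++ m ∷ v) × WeaklyDecreasing (d ++ [ m ]) × Increasing (m ∷ v) × Positive w
hookSplit-sound (x ∷ xs) d m v e with allPos (x ∷ xs) in pos
... | true with splitAcc-sound [] x xs d m v tt e
...   | eq , w , s = eq , w , s , allPos-sound (x ∷ xs) pos

hookSplit-∷ʳ-notHook : ∀ d m y ys a → WeaklyDecreasing (d ++ [ m ]) → m < y → strictInc (m ∷ y ∷ ys ++ [ a ]) ≡ false →
  hookSplit ((d ++ m ∷ y ∷ ys) ++ [ a ]) ≡ nothing
hookSplit-∷ʳ-notHook d m y ys a w m<y inc rewrite ++-assoc d (m ∷ y ∷ ys) [ a ] = hookSplit-notHook d m y (ys ++ [ a ]) w m<y inc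

strictInc-∷ʳ-below : ∀ x l a → a ≤ x → strictInc (x ∷ l ++ [ a ]) ≡ false
strictInc-∷ʳ-below x []      a a≤x = cong (_∧ true) (≥⇒<ᵇ≡false a≤x)
strictInc-∷ʳ-below x (y ∷ l) a a≤x with x <ᵇ y in x<y
... | false = refl
... | true  = strictInc-∷ʳ-below y l a (≤-trans a≤x (<⇒≤ (<ᵇ≡true⇒< x<y)))

hookSplit-∷ʳ-below : ∀ d m y ys a → WeaklyDecreasing (d ++ [ m ]) → m < y → a ≤ y →
  hookSplit ((d ++ m ∷ y ∷ ys) ++ [ a ]) ≡ nothing
hookSplit-∷ʳ-below d m y ys a w m<y a≤y =
  hookSplit-∷ʳ-notHook d m y ys a w m<y (trans (cong ((m <ᵇ y) ∧_) (strictInc-∷ʳ-below y ys a a≤y)) (∧-zeroʳ (m <ᵇ y)))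

notIncreasing⇒someAbove : ∀ m y ys a → Increasing (m ∷ y ∷ ys) → strictInc (m ∷ y ∷ ys ++ [ a ]) ≡ false →
  Any (λ x → (a ≤ᵇ x) ≡ true) (y ∷ ys)
notIncreasing⇒someAbove m y []       a (p , _) e rewrite <⇒<ᵇ≡true p with y <ᵇ a in y<a
... | false = here (≤⇒≤ᵇ≡true {a} {y} (<ᵇ≡false⇒≥ y<a))
notIncreasing⇒someAbove m y (z ∷ ys) a (p , s) e rewrite <⇒<ᵇ≡true p = there (notIncreasing⇒someAbove y z ys a s e)

HookDecomposition : List ℕ → Set
HookDecomposition w = Σ (List ℕ × ℕ × List ℕ) λ where
  (d , m , v) → (w ≡ d ++ m ∷ v) × WeaklyDecreasing (d ++ [ m ]) × Increasing (m ∷ v)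

WeaklyDecreasing∷ʳ++Increasing : ∀ i z M → WeaklyDecreasing (i ++ [ z ]) → Increasing M → HookDecomposition ((i ++ [ z ]) ++ M)
WeaklyDecreasing∷ʳ++Increasing i z []      w s = (i , z , []) , ++-identityʳ _ , w , tt
WeaklyDecreasing∷ʳ++Increasing i z (y ∷ M) w s with z <? y
... | yes z<y = (i , z , y ∷ M) , ++-assoc i [ z ] (y ∷ M) , w , z<y , s
... | no  z≮y = (i ++ [ z ] , y , M) , refl , WeaklyDecreasing-∷ʳ i z y w (≮⇒≥ z≮y) , s

WeaklyDecreasing++Increasing : ∀ l₁ b l₂ M → WeaklyDecreasing (l₁ ++ b ∷ l₂) → Increasing M →
  HookDecomposition ((l₁ ++ b ∷ l₂) ++ M)
WeaklyDecreasing++Increasing l₁ b l₂ M w s with nonempty-∷ʳ l₁ b l₂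
... | (i , z) , eq with WeaklyDecreasing∷ʳ++Increasing i z M (subst WeaklyDecreasing eq w) s
...   | t , eq′ , hook = t , trans (cong (_++ M) eq) eq′ , hook

replaceFirst-head : ∀ (p : ℕ → Bool) z x xs → p x ≡ true → replaceFirst p z (x ∷ xs) ≡ just (x , z ∷ xs)
replaceFirst-head p z x xs px rewrite px = refl

replaceFirst-skip : ∀ (p : ℕ → Bool) z x xs c l → p x ≡ false → replaceFirst p z xs ≡ just (c , l) →
  replaceFirst p z (x ∷ xs) ≡ just (c , x ∷ l)
replaceFirst-skip p z x xs c l px r rewrite px | r = refl

Replacement : (ℕ → Bool) → ℕ → List ℕ → Set
Replacement p z l = Σ (ℕ × List ℕ × List ℕ) λ where
  (c , l₁ , l₂) → (l ≡ l₁ ++ c ∷ l₂) × replaceFirst p z l ≡ just (c , l₁ ++ z ∷ l₂)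
                  × All (λ x → p x ≡ false) l₁ × p c ≡ true

replaceFirst-any : ∀ (p : ℕ → Bool) z l → Any (λ x → p x ≡ true) l → Replacement p z l
replaceFirst-any p z (x ∷ xs) any with p x in px
... | true = (x , [] , xs) , refl , replaceFirst-head p z x xs px , [] , px
replaceFirst-any p z (x ∷ xs) (here px≡true) | false = contradiction (trans (sym px≡true) px) λ ()
replaceFirst-any p z (x ∷ xs) (there any)    | false with replaceFirst-any p z xs any
... | (c , l₁ , l₂) , eq , r , before , pc =
  (c , x ∷ l₁ , l₂) , cong (x ∷_) eq , replaceFirst-skip p z x xs c (l₁ ++ z ∷ l₂) px r , px ∷ before , pc

bumpSite : ∀ d m y → m < y → Replacement (λ x → x <ᵇ y) y (d ++ [ m ])
bumpSite d m y m<y = replaceFirst-any (λ x → x <ᵇ y) y (d ++ [ m ]) (Any-∷ʳ d m (<⇒<ᵇ≡true m<y))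

head-replaced≤ : ∀ v₁ g v₂ b → All (λ x → (g ≤ᵇ x) ≡ false) v₁ → g ≤ b →
  Σ (ℕ × List ℕ) λ where (z , M) → (v₁ ++ g ∷ v₂ ≡ z ∷ M) × z ≤ b
head-replaced≤ []       g v₂ b _            g≤b = (g , v₂) , refl , g≤b
head-replaced≤ (x ∷ v₁) g v₂ b (g>x ∷ _) g≤b = (x , v₁ ++ g ∷ v₂) , refl , <⇒≤ (<-≤-trans (≤ᵇ≡false⇒> g>x) g≤b)

parityOf : Bool → Parity
parityOf b = if b then odd else even

unprimed : ℕ → PN
unprimed n = n ^ false

-- d ++ [ m ] is the weakly decreasing part, m (primed iff p) the middle element, v the increasing part.
row : List ℕ → ℕ → Bool → List ℕ → List PN
row d m p v = map unprimed d ++ (m ^ p) ∷ map unprimed v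

Hook : List ℕ → ℕ → List ℕ → Set
Hook d m v = WeaklyDecreasing (d ++ [ m ]) × Increasing (m ∷ v) × Positive (d ++ m ∷ v)

val∘unprimed : ∀ l → map val (map unprimed l) ≡ l
val∘unprimed []      = refl
val∘unprimed (x ∷ l) = cong (x ∷_) (val∘unprimed l)

vals-row : ∀ d m p v → map val (row d m p v) ≡ d ++ m ∷ v
vals-row d m p v rewrite map-++ val (map unprimed d) ((m ^ p) ∷ map unprimed v) | val∘unprimed d | val∘unprimed v = refl

markAt-row : ∀ d m v b → markAt (length d) b (d ++ m ∷ v) ≡ row d m b v
markAt-row []      m v b = refl
markAt-row (x ∷ d) m v b = cong (unprimed x ∷_) (markAt-row d m v b)

nth-row : ∀ d m p v → nth (row d m p v) (length d) ≡ just (m ^ p)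
nth-row []      m p v = refl
nth-row (x ∷ d) m p v = nth-row d m p v

hookSplit-row : ∀ d m p v → Hook d m v → hookSplit (map val (row d m p v)) ≡ just (d , m , v)
hookSplit-row d m p v (w , s , ps) rewrite vals-row d m p v = hookSplit-complete d m v w s ps

length-row : ∀ d m p v → length (row d m p v) ≡ length (d ++ m ∷ v)
length-row d m p v = trans (sym (length-map val (row d m p v))) (cong length (vals-row d m p v))

reverse-row : ∀ d m p v → reverse (row d m p v) ≡ reverse (map unprimed v) ++ (m ^ p) ∷ reverse (map unprimed d)
reverse-row d m p v
  rewrite reverse-++ (map unprimed d) ((m ^ p) ∷ map unprimed v) | unfold-reverse (m ^ p) (map unprimed v)
  = ++-assoc (reverse (map unprimed v)) [ m ^ p ] (reverse (map unprimed d))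

PrimedRow⇒row : ∀ r → PrimedRow r → Σ (List ℕ × ℕ × Bool × List ℕ) λ where
  (d , m , p , v) → (r ≡ row d m p v) × Hook d m v
PrimedRow⇒row r ((d , m , v) , split , p , r≡) with hookSplit-sound (map val r) d m v split
... | vals≡ , w , s , ps = (d , m , p , v) , trans r≡ (trans (cong (markAt (length d) p) vals≡) (markAt-row d m v p))
                           , w , s , subst Positive vals≡ ps

insRow-appending : ∀ ai r d m v mid d′ m′ v′ → hookSplit (map val r) ≡ just (d , m , v) → nth r (length d) ≡ just mid →
  hookSplit (map val r ++ [ val ai ]) ≡ just (d′ , m′ , v′) →
  insRow ai r ≡ (if length d ≡ᵇ length d′
                 then halt (markAt (length d′) (primed mid) (map val r ++ [ val ai ])) (parityOf (primed ai))
                 else halt (markAt (length d′) (primed ai) (map val r ++ [ val ai ])) (parityOf (primed mid)))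
insRow-appending ai r d m v mid d′ m′ v′ h₁ h₂ h₃ rewrite h₁ | h₂ | h₃ | h₃ with length d ≡ᵇ length d′
... | true  = refl
... | false = refl

insRow-bumping : ∀ ai r d m v mid b v″ c dm d′ m′ v′ → hookSplit (map val r) ≡ just (d , m , v) → nth r (length d) ≡ just mid →
  hookSplit (map val r ++ [ val ai ]) ≡ nothing →
  replaceFirst (λ x → val ai ≤ᵇ x) (val ai) v ≡ just (b , v″) →
  replaceFirst (λ x → x <ᵇ b) b (d ++ [ m ]) ≡ just (c , dm) →
  hookSplit (dm ++ v″) ≡ just (d′ , m′ , v′) →
  insRow ai r ≡ (if length d ≡ᵇ length d′
                 then bump (markAt (length d′) (primed mid) (dm ++ v″)) (c ^ primed ai)
                 else bump (markAt (length d′) (primed ai) (dm ++ v″)) (c ^ primed mid))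
insRow-bumping ai r d m v mid b v″ c dm d′ m′ v′ h₁ h₂ h₃ h₄ h₅ h₆ rewrite h₁ | h₂ | h₃ | h₄ | h₅ | h₆ with length d ≡ᵇ length d′
... | true  = refl
... | false = refl

insRow-append : ∀ d m p v a q d′ m′ v′ → Hook d m v → (d ++ m ∷ v) ++ [ a ] ≡ d′ ++ m′ ∷ v′ → Hook d′ m′ v′ →
  insRow (a ^ q) (row d m p v)
    ≡ (if length d ≡ᵇ length d′ then halt (row d′ m′ p v′) (parityOf q) else halt (row d′ m′ q v′) (parityOf p))
insRow-append d m p v a q d′ m′ v′ hook eq (w′ , s′ , ps′)
  rewrite insRow-appending (a ^ q) (row d m p v) d m v (m ^ p) d′ m′ v′ (hookSplit-row d m p v hook) (nth-row d m p v)
            (trans (cong (λ u → hookSplit (u ++ [ a ])) (vals-row d m p v)) (trans (cong hookSplit eq) (hookSplit-complete d′ m′ v′ w′ s′ ps′)))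
        | vals-row d m p v | eq | markAt-row d′ m′ v′ p | markAt-row d′ m′ v′ q = refl

insRow-bump : ∀ d m p v a q b v″ c dm d′ m′ v′ → Hook d m v → hookSplit ((d ++ m ∷ v) ++ [ a ]) ≡ nothing →
  replaceFirst (λ x → a ≤ᵇ x) a v ≡ just (b , v″) →
  replaceFirst (λ x → x <ᵇ b) b (d ++ [ m ]) ≡ just (c , dm) →
  dm ++ v″ ≡ d′ ++ m′ ∷ v′ → Hook d′ m′ v′ →
  insRow (a ^ q) (row d m p v)
    ≡ (if length d ≡ᵇ length d′ then bump (row d′ m′ p v′) (c ^ q) else bump (row d′ m′ q v′) (c ^ p))
insRow-bump d m p v a q b v″ c dm d′ m′ v′ hook notHook r₁ r₂ eq (w′ , s′ , ps′)
  rewrite insRow-bumping (a ^ q) (row d m p v) d m v (m ^ p) b v″ c dm d′ m′ v′ (hookSplit-row d m p v hook) (nth-row d m p v)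
            (trans (cong (λ u → hookSplit (u ++ [ a ])) (vals-row d m p v)) notHook) r₁ r₂
            (trans (cong hookSplit eq) (hookSplit-complete d′ m′ v′ w′ s′ ps′))
        | eq | markAt-row d′ m′ v′ p | markAt-row d′ m′ v′ q = refl

if-≡ᵇ-equal : ∀ {A : Set} m n (x y : A) → m ≡ n → (if m ≡ᵇ n then x else y) ≡ x
if-≡ᵇ-equal m n x y m≡n rewrite ≡⇒≡ᵇ≡true m≡n = refl

if-≡ᵇ-distinct : ∀ {A : Set} m n (x y : A) → m ≢ n → (if m ≡ᵇ n then x else y) ≡ y
if-≡ᵇ-distinct m n x y m≢n rewrite ≢⇒≡ᵇ≡false m≢n = refl

insRow-append-keepsMiddle : ∀ d m p v a q d′ m′ v′ → Hook d m v → (d ++ m ∷ v) ++ [ a ] ≡ d′ ++ m′ ∷ v′ → Hook d′ m′ v′ →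
  length d ≡ length d′ → insRow (a ^ q) (row d m p v) ≡ halt (row d′ m′ p v′) (parityOf q)
insRow-append-keepsMiddle d m p v a q d′ m′ v′ hook eq hook′ same =
  trans (insRow-append d m p v a q d′ m′ v′ hook eq hook′) (if-≡ᵇ-equal _ _ _ _ same)

insRow-append-movesMiddle : ∀ d m p v a q d′ m′ v′ → Hook d m v → (d ++ m ∷ v) ++ [ a ] ≡ d′ ++ m′ ∷ v′ → Hook d′ m′ v′ →
  length d ≢ length d′ → insRow (a ^ q) (row d m p v) ≡ halt (row d′ m′ q v′) (parityOf p)
insRow-append-movesMiddle d m p v a q d′ m′ v′ hook eq hook′ moved =
  trans (insRow-append d m p v a q d′ m′ v′ hook eq hook′) (if-≡ᵇ-distinct _ _ _ _ moved)

insRow-bump-keepsMiddle : ∀ d m p v a q b v″ c dm d′ m′ v′ → Hook d m v → hookSplit ((d ++ m ∷ v) ++ [ a ]) ≡ nothing →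
  replaceFirst (λ x → a ≤ᵇ x) a v ≡ just (b , v″) → replaceFirst (λ x → x <ᵇ b) b (d ++ [ m ]) ≡ just (c , dm) →
  dm ++ v″ ≡ d′ ++ m′ ∷ v′ → Hook d′ m′ v′ → length d ≡ length d′ →
  insRow (a ^ q) (row d m p v) ≡ bump (row d′ m′ p v′) (c ^ q)
insRow-bump-keepsMiddle d m p v a q b v″ c dm d′ m′ v′ hook notHook r₁ r₂ eq hook′ same =
  trans (insRow-bump d m p v a q b v″ c dm d′ m′ v′ hook notHook r₁ r₂ eq hook′) (if-≡ᵇ-equal _ _ _ _ same)

insRow-bump-movesMiddle : ∀ d m p v a q b v″ c dm d′ m′ v′ → Hook d m v → hookSplit ((d ++ m ∷ v) ++ [ a ]) ≡ nothing →
  replaceFirst (λ x → a ≤ᵇ x) a v ≡ just (b , v″) → replaceFirst (λ x → x <ᵇ b) b (d ++ [ m ]) ≡ just (c , dm) →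
  dm ++ v″ ≡ d′ ++ m′ ∷ v′ → Hook d′ m′ v′ → length d ≢ length d′ →
  insRow (a ^ q) (row d m p v) ≡ bump (row d′ m′ q v′) (c ^ p)
insRow-bump-movesMiddle d m p v a q b v″ c dm d′ m′ v′ hook notHook r₁ r₂ eq hook′ moved =
  trans (insRow-bump d m p v a q b v″ c dm d′ m′ v′ hook notHook r₁ r₂ eq hook′) (if-≡ᵇ-distinct _ _ _ _ moved)

afterStep : Step → Tab → Maybe (Tab × Parity)
afterStep (halt r′ π)  rs = just (r′ ∷ rs , π)
afterStep (bump r′ y′) rs = decIns y′ rs >>= λ where (T , π) → just (r′ ∷ T , π)
afterStep fail         rs = nothing

decIns-∷ : ∀ y x r rs → decIns y ((x ∷ r) ∷ rs) ≡ afterStep (insRow y (x ∷ r)) rs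
decIns-∷ y x r rs with insRow y (x ∷ r)
... | halt _ _ = refl
... | bump _ _ = refl
... | fail     = refl

decIns-row : ∀ y d m p v rs → decIns y (row d m p v ∷ rs) ≡ afterStep (insRow y (row d m p v)) rs
decIns-row y []      m p v rs = decIns-∷ y (m ^ p) (map unprimed v) rs
decIns-row y (x ∷ d) m p v rs = decIns-∷ y (unprimed x) (map unprimed d ++ (m ^ p) ∷ map unprimed v) rs

decIns-halt : ∀ y d m p v rs r′ π → insRow y (row d m p v) ≡ halt r′ π → decIns y (row d m p v ∷ rs) ≡ just (r′ ∷ rs , π)
decIns-halt y d m p v rs r′ π e rewrite decIns-row y d m p v rs | e = refl

decIns-bump : ∀ y d m p v rs r′ y′ T π → insRow y (row d m p v) ≡ bump r′ y′ → decIns y′ rs ≡ just (T , π) →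
  decIns y (row d m p v ∷ rs) ≡ just (r′ ∷ T , π)
decIns-bump y d m p v rs r′ y′ T π e e′ rewrite decIns-row y d m p v rs | e | e′ = refl

HookRowWith : (ℕ → Set) → List PN → Set
HookRowWith Q r = Σ (List ℕ × ℕ × Bool × List ℕ) λ where
  (d , m , p , v) → (r ≡ row d m p v) × Hook d m v × All Q (d ++ m ∷ v)

StepWith : (ℕ → Set) → Step → Set
StepWith Q (halt r π) = HookRowWith Q r
StepWith Q (bump r y) = HookRowWith Q r × 1 ≤ val y × Q (val y)
StepWith Q fail       = ⊥

StepWith-if : ∀ {Q} b x y → StepWith Q x → StepWith Q y → StepWith Q (if b then x else y)
StepWith-if true  x y sx sy = sx
StepWith-if false x y sx sy = sy

insRow-succeeds-append : ∀ Q d m p v a q d′ m′ v′ → Hook d m v → (d ++ m ∷ v) ++ [ a ] ≡ d′ ++ m′ ∷ v′ →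
  Hook d′ m′ v′ → All Q (d′ ++ m′ ∷ v′) → Σ Step λ st → (insRow (a ^ q) (row d m p v) ≡ st) × StepWith Q st
insRow-succeeds-append Q d m p v a q d′ m′ v′ hook eq hook′ qs =
  _ , insRow-append d m p v a q d′ m′ v′ hook eq hook′
    , StepWith-if (length d ≡ᵇ length d′) (halt (row d′ m′ p v′) (parityOf q)) (halt (row d′ m′ q v′) (parityOf p))
                  (_ , refl , hook′ , qs) (_ , refl , hook′ , qs)

insRow-succeeds-bump : ∀ Q d m p y ys a q → Hook d m (y ∷ ys) → 1 ≤ a → All Q (d ++ m ∷ y ∷ ys) → Q a →
  strictInc (m ∷ y ∷ ys ++ [ a ]) ≡ false → Σ Step λ st → (insRow (a ^ q) (row d m p (y ∷ ys)) ≡ st) × StepWith Q st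
insRow-succeeds-bump Q d m p y ys a q (w , s , ps) 1≤a qs qa inc
  with replaceFirst-any (λ x → a ≤ᵇ x) a (y ∷ ys) (notIncreasing⇒someAbove m y ys a s inc)
... | (b , v₁ , v₂) , v≡ , r₁ , before₁ , a≤b
  with replaceFirst-any (λ x → x <ᵇ b) b (d ++ [ m ])
         (Any-∷ʳ d m (<⇒<ᵇ≡true (All-middle v₁ b v₂ (subst (All (m <_)) v≡ (Increasing⇒All>head m (y ∷ ys) s)))))
... | (c , e₁ , e₂) , dm≡ , r₂ , before₂ , c<b
  with WeaklyDecreasing++Increasing e₁ b e₂ (v₁ ++ a ∷ v₂)
         (WeaklyDecreasing-replace e₁ c e₂ b (subst WeaklyDecreasing dm≡ w) before₂ (<⇒≤ (<ᵇ≡true⇒< c<b)))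
         (Increasing-replace v₁ b v₂ a (subst Increasing v≡ (Increasing-tail (y ∷ ys) s)) before₁ (≤ᵇ≡true⇒≤ a≤b))
... | (d′ , m′ , v′) , new≡ , w′ , s′ =
  _ , insRow-bump d m p (y ∷ ys) a q b (v₁ ++ a ∷ v₂) c (e₁ ++ b ∷ e₂) d′ m′ v′ (w , s , ps) (hookSplit-∷ʳ-notHook d m y ys a w (proj₁ s) inc) r₁ r₂ new≡ hook′
    , StepWith-if (length d ≡ᵇ length d′) (bump (row d′ m′ p v′) (c ^ q)) (bump (row d′ m′ q v′) (c ^ p))
                  ((_ , refl , hook′ , newRow qs qa) , bumped ps , bumped qs)
                  ((_ , refl , hook′ , newRow qs qa) , bumped ps , bumped qs)
  where
  parts : ∀ {R : ℕ → Set} → All R (d ++ m ∷ y ∷ ys) → All R (e₁ ++ c ∷ e₂) × All R (v₁ ++ b ∷ v₂)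
  parts {R} al with All-∷-split d m (y ∷ ys) al
  ... | left , right = subst (All R) dm≡ left , subst (All R) v≡ right
  newRow : ∀ {R : ℕ → Set} → All R (d ++ m ∷ y ∷ ys) → R a → All R (d′ ++ m′ ∷ v′)
  newRow {R} al ra = subst (All R) new≡ (++⁺ (All-replace e₁ c e₂ b (proj₁ (parts al)) (All-middle v₁ b v₂ (proj₂ (parts al))))
                                              (All-replace v₁ b v₂ a (proj₂ (parts al)) ra))
  hook′ : Hook d′ m′ v′
  hook′ = w′ , s′ , newRow ps 1≤a
  bumped : ∀ {R : ℕ → Set} → All R (d ++ m ∷ y ∷ ys) → R c
  bumped al = All-middle e₁ c e₂ (proj₁ (parts al))

insRow-succeeds : ∀ Q d m p v a q → Hook d m v → 1 ≤ a → All Q (d ++ m ∷ v) → Q a →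
  Σ Step λ st → (insRow (a ^ q) (row d m p v) ≡ st) × StepWith Q st
insRow-succeeds Q d m p v a q (w , s , ps) 1≤a qs qa with strictInc (m ∷ v ++ [ a ]) in inc
... | true = insRow-succeeds-append Q d m p v a q d m (v ++ [ a ]) (w , s , ps) (++-assoc d (m ∷ v) [ a ])
               (w , strictInc-sound (m ∷ v ++ [ a ]) inc , subst Positive (++-assoc d (m ∷ v) [ a ]) (++⁺ ps (1≤a ∷ [])))
               (subst (All Q) (++-assoc d (m ∷ v) [ a ]) (++⁺ qs (qa ∷ [])))
insRow-succeeds Q d m p [] a q (w , s , ps) 1≤a qs qa | false =
  insRow-succeeds-append Q d m p [] a q (d ++ [ m ]) a [] (w , s , ps) refl
    (WeaklyDecreasing-∷ʳ d m a w a≤m , tt , ++⁺ ps (1≤a ∷ [])) (++⁺ qs (qa ∷ []))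
  where
  a≤m : a ≤ m
  a≤m = <ᵇ≡false⇒≥ (trans (sym (∧-identityʳ (m <ᵇ a))) inc)
insRow-succeeds Q d m p (y ∷ ys) a q hook 1≤a qs qa | false = insRow-succeeds-bump Q d m p y ys a q hook 1≤a qs qa inc

decIns-succeeds : ∀ (Q : ℕ → Set) rs → All (HookRowWith Q) rs → ∀ y → 1 ≤ val y → Q (val y) →
  Σ (Tab × Parity) λ res → decIns y rs ≡ just res
decIns-succeeds Q []       []  y _ _ = _ , refl
decIns-succeeds Q (r ∷ rs) (((d , m , p , v) , refl , hook , qs) ∷ hooks) (a ^ q) 1≤a qa
  rewrite decIns-row (a ^ q) d m p v rs with insRow-succeeds Q d m p v a q hook 1≤a qs qa
... | halt r′ π  , eq , _ rewrite eq = _ , refl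
... | bump r′ y′ , eq , (_ , 1≤y′ , qy′) rewrite eq with decIns-succeeds Q rs hooks y′ 1≤y′ qy′
...   | res , e rewrite e = _ , refl

insRow-belowMiddle : ∀ d m p a q → Hook d m [] → 1 ≤ a → a ≤ m →
  insRow (a ^ q) (row d m p []) ≡ halt (row (d ++ [ m ]) a q []) (parityOf p)
insRow-belowMiddle d m p a q (w , s , ps) 1≤a a≤m =
  insRow-append-movesMiddle d m p [] a q (d ++ [ m ]) a [] (w , s , ps) refl
    (WeaklyDecreasing-∷ʳ d m a w a≤m , tt , ++⁺ ps (1≤a ∷ [])) (length≢length-∷ʳ d m)

-- a ≤ y displaces the first entry y of the increasing part, which in turn displaces c
-- from the weakly decreasing part; a becomes the new middle element.
insRow-belowIncreasing : ∀ d m p y ys c e₁ e₂ a q → Hook d m (y ∷ ys) →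
  d ++ [ m ] ≡ e₁ ++ c ∷ e₂ → replaceFirst (λ x → x <ᵇ y) y (d ++ [ m ]) ≡ just (c , e₁ ++ y ∷ e₂) →
  All (λ x → (x <ᵇ y) ≡ false) e₁ → (c <ᵇ y) ≡ true →
  1 ≤ a → a ≤ y → All (a ≤_) (e₁ ++ y ∷ e₂) →
  insRow (a ^ q) (row d m p (y ∷ ys)) ≡ bump (row (e₁ ++ y ∷ e₂) a q ys) (c ^ p)
insRow-belowIncreasing d m p y ys c e₁ e₂ a q (w , s , ps) dm≡ r₂ before c<y 1≤a a≤y a≤D =
  insRow-bump-movesMiddle d m p (y ∷ ys) a q y (a ∷ ys) c D D a ys (w , s , ps)
    (hookSplit-∷ʳ-below d m y ys a w (proj₁ s) a≤y) (replaceFirst-head (λ x → a ≤ᵇ x) a y ys (≤⇒≤ᵇ≡true a≤y)) r₂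
    refl hook′ moved
  where
  D = e₁ ++ y ∷ e₂
  split : Positive (d ++ [ m ]) × Positive (y ∷ ys)
  split = All-∷-split d m (y ∷ ys) ps
  hook′ : Hook D a ys
  hook′ = WeaklyDecreasing-∷ʳ-All D a
            (WeaklyDecreasing-replace e₁ c e₂ y (subst WeaklyDecreasing dm≡ w) before (<⇒≤ (<ᵇ≡true⇒< c<y))) a≤D
        , Increasing-lowerHead ys a≤y (Increasing-tail (y ∷ ys) s)
        , ++⁺ (All-replace e₁ c e₂ y (subst Positive dm≡ (proj₁ split)) (All.head (proj₂ split)))
              (1≤a ∷ All.tail (proj₂ split))
  moved : length d ≢ length D
  moved eq = length≢length-∷ʳ d m (trans eq (trans (length-replace e₁ y c e₂) (cong length (sym dm≡))))

-- Tableaux that differ only in the prime on their first 1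

HookRow : List PN → Set
HookRow = HookRowWith (λ _ → ⊤)

SameShape : Tab → Tab → Set
SameShape []       []         = ⊤
SameShape (r ∷ R)  (r′ ∷ R′)  = (length r ≡ length r′) × SameShape R R′
SameShape []       (_ ∷ _)    = ⊥
SameShape (_ ∷ _)  []         = ⊥

SameShape-refl : ∀ R → SameShape R R
SameShape-refl []      = tt
SameShape-refl (r ∷ R) = refl , SameShape-refl R

SameShape-++ : ∀ rs {R R′} → SameShape R R′ → SameShape (rs ++ R) (rs ++ R′)
SameShape-++ []       same = same
SameShape-++ (r ∷ rs) same = refl , SameShape-++ rs same

NotOne : PN → Set
NotOne y = val y ≢ 1

≥2⇒NotOne : ∀ y → 2 ≤ val y → NotOne y
≥2⇒NotOne _ (s≤s ()) refl

unprimed-NotOne : ∀ l → All (2 ≤_) l → All NotOne (reverse (map unprimed l))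
unprimed-NotOne l al = All-reverse (map unprimed l) (map⁺ (All.map (λ {x} → ≥2⇒NotOne (unprimed x)) al))

row-NotOne : ∀ d m p v → All (2 ≤_) (d ++ m ∷ v) → All NotOne (reverse (row d m p v))
row-NotOne d m p v al rewrite reverse-row d m p v with ++⁻ d al
... | ds , m≥2 ∷ vs = ++⁺ (unprimed-NotOne v vs) (≥2⇒NotOne (m ^ p) m≥2 ∷ unprimed-NotOne d ds)

length-row-cong : ∀ d m p v d′ m′ p′ v′ → length (d ++ m ∷ v) ≡ length (d′ ++ m′ ∷ v′) →
  length (row d m p v) ≡ length (row d′ m′ p′ v′)
length-row-cong d m p v d′ m′ p′ v′ eq = trans (length-row d m p v) (trans eq (sym (length-row d′ m′ p′ v′)))

DifferAtFirstOne : Bool → Bool → Tab → Tab → Set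
DifferAtFirstOne p p′ R R′ = Σ (List PN × List PN) λ where
  (B , C) → (revrow R ≡ B ++ (1 ^ p) ∷ C) × (revrow R′ ≡ B ++ (1 ^ p′) ∷ C) × All NotOne B × SameShape R R′

DifferAtFirstOne-∷ : ∀ {p p′ R R′} r → All NotOne (reverse r) → DifferAtFirstOne p p′ R R′ →
  DifferAtFirstOne p p′ (r ∷ R) (r ∷ R′)
DifferAtFirstOne-∷ r notOne ((B , C) , e , e′ , notOneB , same) =
  (reverse r ++ B , C) , trans (cong (reverse r ++_) e) (sym (++-assoc (reverse r) B _))
  , trans (cong (reverse r ++_) e′) (sym (++-assoc (reverse r) B _)) , ++⁺ notOne notOneB , refl , same

DifferAtFirstOne-++ : ∀ {p p′ R R′} rs → All (HookRowWith (2 ≤_)) rs → DifferAtFirstOne p p′ R R′ →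
  DifferAtFirstOne p p′ (rs ++ R) (rs ++ R′)
DifferAtFirstOne-++ []       []  diff = diff
DifferAtFirstOne-++ (_ ∷ rs) (((d , m , q , v) , refl , _ , ≥2) ∷ hooks) diff =
  DifferAtFirstOne-∷ (row d m q v) (row-NotOne d m q v ≥2) (DifferAtFirstOne-++ rs hooks diff)

-- Read right to left, the increasing part comes first and contains no 1.
DifferAtFirstOne-row : ∀ d p p′ v rest → All (2 ≤_) v → DifferAtFirstOne p p′ (row d 1 p v ∷ rest) (row d 1 p′ v ∷ rest)
DifferAtFirstOne-row d p p′ v rest v≥2 =
  (reverse (map unprimed v) , reverse (map unprimed d) ++ revrow rest)
  , trans (cong (_++ revrow rest) (reverse-row d 1 p v)) (++-assoc (reverse (map unprimed v)) _ (revrow rest))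
  , trans (cong (_++ revrow rest) (reverse-row d 1 p′ v)) (++-assoc (reverse (map unprimed v)) _ (revrow rest))
  , unprimed-NotOne v v≥2 , length-row-cong d 1 p v d 1 p′ v refl , SameShape-refl rest

InsertionsRelated : (Tab → Tab → Set) → PN → Tab → PN → Tab → Set
InsertionsRelated Rel y P y′ P′ = Σ (Tab × Tab × Parity) λ where
  (R , R′ , π) → (decIns y P ≡ just (R , π)) × (decIns y′ P′ ≡ just (R′ , π)) × Rel R R′

decIns-1 : ∀ rs → All HookRow rs → ∀ p p′ → InsertionsRelated (DifferAtFirstOne p p′) (1 ^ p) rs (1 ^ p′) rs
decIns-1 [] [] p p′ = ([ [ 1 ^ p ] ] , [ [ 1 ^ p′ ] ] , even) , refl , refl , ([] , []) , refl , refl , [] , refl , tt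
decIns-1 (_ ∷ rs) (((d , m , q , []) , refl , hook , _) ∷ _) p p′ =
  (_ , _ , parityOf q) , decIns-halt _ d m q [] rs _ _ (step p) , decIns-halt _ d m q [] rs _ _ (step p′)
  , DifferAtFirstOne-row (d ++ [ m ]) p p′ [] rs []
  where
  step : ∀ b → insRow (1 ^ b) (row d m q []) ≡ halt (row (d ++ [ m ]) 1 b []) (parityOf q)
  step b = insRow-belowMiddle d m q 1 b hook ≤-refl (All-middle d m [] (proj₂ (proj₂ hook)))
decIns-1 (_ ∷ rs) (((d , m , q , y ∷ ys) , refl , hook@(_ , s , ps) , _) ∷ hooks) p p′
  with All-∷-split d m (y ∷ ys) ps | bumpSite d m y (proj₁ s)
... | dmPos , y≥1 ∷ _ | (c , e₁ , e₂) , dm≡ , r₂ , before , c<y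
  with decIns-succeeds (λ _ → ⊤) rs hooks (c ^ q) (All-middle e₁ c e₂ (subst Positive dm≡ dmPos)) tt
... | (T , π) , eT =
  (_ , _ , π) , decIns-bump _ d m q (y ∷ ys) rs _ _ T π (step p) eT , decIns-bump _ d m q (y ∷ ys) rs _ _ T π (step p′) eT
  , DifferAtFirstOne-row (e₁ ++ y ∷ e₂) p p′ ys T (All.map (≤-<-trans y≥1) (Increasing⇒All>head y ys (proj₂ s)))
  where
  step : ∀ b → insRow (1 ^ b) (row d m q (y ∷ ys)) ≡ bump (row (e₁ ++ y ∷ e₂) 1 b ys) (c ^ q)
  step b = insRow-belowIncreasing d m q y ys c e₁ e₂ 1 b hook dm≡ r₂ before c<y ≤-refl y≥1
             (All-replace e₁ c e₂ y (subst Positive dm≡ dmPos) y≥1)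

-- b displaces the middle 1, which carries its prime down to the rows below.
decIns-≥2-rowOfOne-bumpMiddle : ∀ d y ys p p′ rest g q b v₁ v₂ → Hook d 1 (y ∷ ys) → All HookRow rest → 2 ≤ g →
  strictInc (1 ∷ y ∷ ys ++ [ g ]) ≡ false →
  y ∷ ys ≡ v₁ ++ b ∷ v₂ → replaceFirst (λ x → g ≤ᵇ x) g (y ∷ ys) ≡ just (b , v₁ ++ g ∷ v₂) →
  All (λ x → (g ≤ᵇ x) ≡ false) v₁ → (g ≤ᵇ b) ≡ true →
  replaceFirst (λ x → x <ᵇ b) b (d ++ [ 1 ]) ≡ just (1 , d ++ [ b ]) → All (λ x → (x <ᵇ b) ≡ false) d →
  InsertionsRelated (DifferAtFirstOne p p′) (g ^ q) (row d 1 p (y ∷ ys) ∷ rest) (g ^ q) (row d 1 p′ (y ∷ ys) ∷ rest)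
decIns-≥2-rowOfOne-bumpMiddle d y ys p p′ rest g q b v₁ v₂ (w , s , ps) hooks g≥2 inc v≡ r₁ before₁ g≤b r₂ before₂
  with head-replaced≤ v₁ g v₂ b before₁ (≤ᵇ≡true⇒≤ g≤b) | decIns-1 rest hooks p p′
... | (z , M) , new≡ , z≤b | (R , R′ , π) , e , e′ , diff =
  (_ , _ , π) , decIns-bump _ d 1 p (y ∷ ys) rest _ _ R π (step p) e , decIns-bump _ d 1 p′ (y ∷ ys) rest _ _ R′ π (step p′) e′
  , DifferAtFirstOne-∷ (row (d ++ [ b ]) z q M) (row-NotOne (d ++ [ b ]) z q M ≥2) diff
  where
  b≥2 : 2 ≤ b
  b≥2 = ≤-trans g≥2 (≤ᵇ≡true⇒≤ g≤b)
  v>1 : All (1 <_) (v₁ ++ b ∷ v₂)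
  v>1 = subst (All (1 <_)) v≡ (Increasing⇒All>head 1 (y ∷ ys) s)
  ≥2 : All (2 ≤_) ((d ++ [ b ]) ++ z ∷ M)
  ≥2 = ++⁺ (++⁺ (All.map (λ b≤x → ≤-trans b≥2 (<ᵇ≡false⇒≥ b≤x)) before₂) (b≥2 ∷ []))
           (subst (All (2 ≤_)) new≡ (All-replace v₁ b v₂ g v>1 g≥2))
  hook′ : Hook (d ++ [ b ]) z M
  hook′ = WeaklyDecreasing-∷ʳ d b z (WeaklyDecreasing-replace d 1 [] b w before₂ (<⇒≤ b≥2)) z≤b
        , subst Increasing new≡ (Increasing-replace v₁ b v₂ g (subst Increasing v≡ (Increasing-tail (y ∷ ys) s)) before₁ (≤ᵇ≡true⇒≤ g≤b))
        , All.map (≤-trans (s≤s z≤n)) ≥2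
  step : ∀ p″ → insRow (g ^ q) (row d 1 p″ (y ∷ ys)) ≡ bump (row (d ++ [ b ]) z q M) (1 ^ p″)
  step p″ = insRow-bump-movesMiddle d 1 p″ (y ∷ ys) g q b (v₁ ++ g ∷ v₂) 1 (d ++ [ b ]) (d ++ [ b ]) z M (w , s , ps)
              (hookSplit-∷ʳ-notHook d 1 y ys g w (proj₁ s) inc) r₁ r₂ (cong ((d ++ [ b ]) ++_) new≡) hook′ (length≢length-∷ʳ d b)

-- b displaces an entry c of the weakly decreasing part; the middle 1 stays in place.
decIns-≥2-rowOfOne-bumpDecreasing : ∀ e₁ c e₂ y ys p p′ rest g q b v₁ v₂ → Hook (e₁ ++ c ∷ e₂) 1 (y ∷ ys) → All HookRow rest → 2 ≤ g →
  strictInc (1 ∷ y ∷ ys ++ [ g ]) ≡ false →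
  y ∷ ys ≡ v₁ ++ b ∷ v₂ → replaceFirst (λ x → g ≤ᵇ x) g (y ∷ ys) ≡ just (b , v₁ ++ g ∷ v₂) →
  All (λ x → (g ≤ᵇ x) ≡ false) v₁ → (g ≤ᵇ b) ≡ true →
  (e₁ ++ c ∷ e₂) ++ [ 1 ] ≡ e₁ ++ c ∷ e₂ ++ [ 1 ] →
  replaceFirst (λ x → x <ᵇ b) b ((e₁ ++ c ∷ e₂) ++ [ 1 ]) ≡ just (c , e₁ ++ b ∷ e₂ ++ [ 1 ]) →
  All (λ x → (x <ᵇ b) ≡ false) e₁ → (c <ᵇ b) ≡ true →
  InsertionsRelated (DifferAtFirstOne p p′) (g ^ q) (row (e₁ ++ c ∷ e₂) 1 p (y ∷ ys) ∷ rest) (g ^ q) (row (e₁ ++ c ∷ e₂) 1 p′ (y ∷ ys) ∷ rest)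
decIns-≥2-rowOfOne-bumpDecreasing e₁ c e₂ y ys p p′ rest g q b v₁ v₂ (w , s , ps) hooks g≥2 inc v≡ r₁ before₁ g≤b dm≡ r₂ before₂ c<b
  with All-∷-split (e₁ ++ c ∷ e₂) 1 (y ∷ ys) ps
... | dmPos , vPos with decIns-succeeds (λ _ → ⊤) rest hooks (c ^ q) (All-middle e₁ c (e₂ ++ [ 1 ]) (subst Positive dm≡ dmPos)) tt
... | (T , π) , eT =
  (_ , _ , π) , decIns-bump _ d 1 p (y ∷ ys) rest _ _ T π (step p) eT , decIns-bump _ d 1 p′ (y ∷ ys) rest _ _ T π (step p′) eT
  , DifferAtFirstOne-row (e₁ ++ b ∷ e₂) p p′ v′ T v′≥2
  where
  d = e₁ ++ c ∷ e₂
  v′ = v₁ ++ g ∷ v₂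
  v′≥2 : All (2 ≤_) v′
  v′≥2 = All-replace v₁ b v₂ g (subst (All (1 <_)) v≡ (Increasing⇒All>head 1 (y ∷ ys) s)) g≥2
  reassoc : (e₁ ++ b ∷ e₂ ++ [ 1 ]) ++ v′ ≡ (e₁ ++ b ∷ e₂) ++ 1 ∷ v′
  reassoc = trans (++-assoc e₁ (b ∷ e₂ ++ [ 1 ]) v′)
              (trans (cong (λ l → e₁ ++ b ∷ l) (++-assoc e₂ [ 1 ] v′)) (sym (++-assoc e₁ (b ∷ e₂) (1 ∷ v′))))
  w′ : WeaklyDecreasing (e₁ ++ b ∷ e₂ ++ [ 1 ])
  w′ = WeaklyDecreasing-replace e₁ c (e₂ ++ [ 1 ]) b (subst WeaklyDecreasing dm≡ w) before₂ (<⇒≤ (<ᵇ≡true⇒< c<b))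
  hook′ : Hook (e₁ ++ b ∷ e₂) 1 v′
  hook′ = subst WeaklyDecreasing (sym (++-assoc e₁ (b ∷ e₂) [ 1 ])) w′
        , Increasing-∷ v′ (Increasing-replace v₁ b v₂ g (subst Increasing v≡ (Increasing-tail (y ∷ ys) s)) before₁ (≤ᵇ≡true⇒≤ g≤b)) v′≥2
        , subst Positive reassoc
            (++⁺ (All-replace e₁ c (e₂ ++ [ 1 ]) b (subst Positive dm≡ dmPos) (All-middle v₁ b v₂ (subst Positive v≡ vPos)))
                 (All-replace v₁ b v₂ g (subst Positive v≡ vPos) (≤-trans (s≤s z≤n) g≥2)))
  step : ∀ p″ → insRow (g ^ q) (row d 1 p″ (y ∷ ys)) ≡ bump (row (e₁ ++ b ∷ e₂) 1 p″ v′) (c ^ q)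
  step p″ = insRow-bump-keepsMiddle d 1 p″ (y ∷ ys) g q b v′ c (e₁ ++ b ∷ e₂ ++ [ 1 ]) (e₁ ++ b ∷ e₂) 1 v′ (w , s , ps)
              (hookSplit-∷ʳ-notHook d 1 y ys g w (proj₁ s) inc) r₁ r₂ reassoc hook′ (length-replace e₁ c b e₂)

decIns-≥2-rowOfOne : ∀ d v p p′ rest → Hook d 1 v → All HookRow rest → ∀ g q → 2 ≤ g →
  InsertionsRelated (DifferAtFirstOne p p′) (g ^ q) (row d 1 p v ∷ rest) (g ^ q) (row d 1 p′ v ∷ rest)
decIns-≥2-rowOfOne d v p p′ rest (w , s , ps) hooks g q g≥2 with strictInc (1 ∷ v ++ [ g ]) in inc
... | true =
  (_ , _ , parityOf q) , decIns-halt _ d 1 p v rest _ _ (step p) , decIns-halt _ d 1 p′ v rest _ _ (step p′)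
  , DifferAtFirstOne-row d p p′ (v ++ [ g ]) rest (Increasing⇒All>head 1 (v ++ [ g ]) (strictInc-sound _ inc))
  where
  hook′ : Hook d 1 (v ++ [ g ])
  hook′ = w , strictInc-sound _ inc , subst Positive (++-assoc d (1 ∷ v) [ g ]) (++⁺ ps (≤-trans (s≤s z≤n) g≥2 ∷ []))
  step : ∀ p″ → insRow (g ^ q) (row d 1 p″ v) ≡ halt (row d 1 p″ (v ++ [ g ])) (parityOf q)
  step p″ = insRow-append-keepsMiddle d 1 p″ v g q d 1 (v ++ [ g ]) (w , s , ps) (++-assoc d (1 ∷ v) [ g ]) hook′ refl
decIns-≥2-rowOfOne d [] p p′ rest _ hooks g q g≥2 | false =
  contradiction (trans (sym inc) (cong (_∧ true) (<⇒<ᵇ≡true g≥2))) λ ()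
decIns-≥2-rowOfOne d (y ∷ ys) p p′ rest (w , s , ps) hooks g q g≥2 | false
  with replaceFirst-any (λ x → g ≤ᵇ x) g (y ∷ ys) (notIncreasing⇒someAbove 1 y ys g s inc)
... | (b , v₁ , v₂) , v≡ , r₁ , before₁ , g≤b
  with replaceFirst-any (λ x → x <ᵇ b) b (d ++ [ 1 ]) (Any-∷ʳ d 1 (<⇒<ᵇ≡true (≤-trans g≥2 (≤ᵇ≡true⇒≤ g≤b))))
... | (c , e₁ , e₂) , dm≡ , r₂ , before₂ , c<b with ∷ʳ-split d 1 e₁ c e₂ dm≡
... | inj₁ (refl , refl , refl) =
  decIns-≥2-rowOfOne-bumpMiddle d y ys p p′ rest g q b v₁ v₂ (w , s , ps) hooks g≥2 inc v≡ r₁ before₁ g≤b r₂ before₂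
... | inj₂ (e₂′ , refl , refl) =
  decIns-≥2-rowOfOne-bumpDecreasing e₁ c e₂′ y ys p p′ rest g q b v₁ v₂ (w , s , ps) hooks g≥2 inc v≡ r₁ before₁ g≤b dm≡ r₂ before₂ c<b

decIns-≥2 : ∀ rows₀ → All (HookRowWith (2 ≤_)) rows₀ → ∀ d v p p′ rest → Hook d 1 v → All HookRow rest →
  ∀ g q → 2 ≤ g →
  InsertionsRelated (DifferAtFirstOne p p′) (g ^ q) (rows₀ ++ row d 1 p v ∷ rest) (g ^ q) (rows₀ ++ row d 1 p′ v ∷ rest)
decIns-≥2 [] [] = decIns-≥2-rowOfOne
decIns-≥2 (_ ∷ rows₀) (((d₀ , m₀ , p₀ , v₀) , refl , hook₀ , ≥2₀) ∷ hooks₀) d v p p′ rest hook hooks g q g≥2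
  with insRow-succeeds (2 ≤_) d₀ m₀ p₀ v₀ g q hook₀ (≤-trans (s≤s z≤n) g≥2) ≥2₀ g≥2
... | fail , _ , ()
... | halt r′ π , eq , ((d₁ , m₁ , p₁ , v₁) , refl , _ , ≥2₁) =
  (_ , _ , π) , decIns-halt _ d₀ m₀ p₀ v₀ _ r′ π eq , decIns-halt _ d₀ m₀ p₀ v₀ _ r′ π eq
  , DifferAtFirstOne-∷ r′ (row-NotOne d₁ m₁ p₁ v₁ ≥2₁)
      (DifferAtFirstOne-++ rows₀ hooks₀ (DifferAtFirstOne-row d p p′ v rest (Increasing⇒All>head 1 v (proj₁ (proj₂ hook)))))
... | bump r′ (g′ ^ q′) , eq , (((d₁ , m₁ , p₁ , v₁) , refl , _ , ≥2₁) , _ , g′≥2)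
  with decIns-≥2 rows₀ hooks₀ d v p p′ rest hook hooks g′ q′ g′≥2
...   | (R , R′ , π) , e , e′ , diff =
  (_ , _ , π) , decIns-bump _ d₀ m₀ p₀ v₀ _ r′ _ R π eq e , decIns-bump _ d₀ m₀ p₀ v₀ _ r′ _ R′ π eq e′
  , DifferAtFirstOne-∷ r′ (row-NotOne d₁ m₁ p₁ v₁ ≥2₁) diff

-- The crystal operator on tableaux related by a 2/1 swap

firstIdx-++-∷ : ∀ {A : Set} (p : A → Bool) l x rest → All (λ z → p z ≡ false) l → p x ≡ true →
  firstIdx p (l ++ x ∷ rest) ≡ just (length l)
firstIdx-++-∷ p []      x rest []       px rewrite px = refl
firstIdx-++-∷ p (a ∷ l) x rest (pa ∷ al) px rewrite pa | firstIdx-++-∷ p l x rest al px = refl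

nth-++-∷ : ∀ {A : Set} (l : List A) x rest → nth (l ++ x ∷ rest) (length l) ≡ just x
nth-++-∷ []      x rest = refl
nth-++-∷ (a ∷ l) x rest = nth-++-∷ l x rest

modifyAt-++-∷ : ∀ {A : Set} (l : List A) x rest f → modifyAt (length l) f (l ++ x ∷ rest) ≡ l ++ f x ∷ rest
modifyAt-++-∷ []      x rest f = refl
modifyAt-++-∷ (a ∷ l) x rest f = cong (a ∷_) (modifyAt-++-∷ l x rest f)

e1w-swap : ∀ w j k wj wk → firstIdx is2 w ≡ just j → firstIdx is1 w ≡ just k → (k <ᵇ j) ≡ false →
  nth w j ≡ just wj → nth w k ≡ just wk → e1w w ≡ just (modifyAt k (λ _ → minus1 wj) (modifyAt j (λ _ → wk) w))
e1w-swap w j k wj wk h₁ h₂ h₃ h₄ h₅ rewrite h₁ | h₂ | h₃ | h₄ | h₅ = refl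

NotOneOrTwo : PN → Set
NotOneOrTwo y = NotOne y × val y ≢ 2

e1w-++ : ∀ A B C x y → All NotOneOrTwo A → All NotOne B → val x ≡ 2 → val y ≡ 1 →
  e1w (A ++ x ∷ B ++ y ∷ C) ≡ just (A ++ y ∷ B ++ minus1 x ∷ C)
e1w-++ A B C x y notA notB x≡2 y≡1 =
  trans (e1w-swap w (length A) (length (A ++ x ∷ B)) x y first2 first1 (≥⇒<ᵇ≡false (<⇒≤ 2before1)) (nth-++-∷ A x _) nth1)
        (cong just (trans (cong (modifyAt (length (A ++ x ∷ B)) (λ _ → minus1 x)) (modifyAt-++-∷ A x (B ++ y ∷ C) (λ _ → y)))
                          swapped))
  where
  w = A ++ x ∷ B ++ y ∷ C
  reassoc : ∀ (z : PN) → A ++ z ∷ B ++ y ∷ C ≡ (A ++ z ∷ B) ++ y ∷ C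
  reassoc z = sym (++-assoc A (z ∷ B) (y ∷ C))
  2before1 : length A < length (A ++ x ∷ B)
  2before1 = subst (length A <_) (sym (length-++ A)) (m<m+n (length A) (s≤s z≤n))
  first2 : firstIdx is2 w ≡ just (length A)
  first2 = firstIdx-++-∷ is2 A x _ (All.map (λ n → ≢⇒≡ᵇ≡false (proj₂ n)) notA) (≡⇒≡ᵇ≡true x≡2)
  first1 : firstIdx is1 w ≡ just (length (A ++ x ∷ B))
  first1 rewrite reassoc x =
    firstIdx-++-∷ is1 (A ++ x ∷ B) y C
      (++⁺ (All.map (λ n → ≢⇒≡ᵇ≡false (proj₁ n)) notA)
           (≢⇒≡ᵇ≡false (λ x≡1 → 1+n≢n (trans (sym x≡2) x≡1)) ∷ All.map ≢⇒≡ᵇ≡false notB))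
      (≡⇒≡ᵇ≡true y≡1)
  nth1 : nth w (length (A ++ x ∷ B)) ≡ just y
  nth1 rewrite reassoc x = nth-++-∷ (A ++ x ∷ B) y C
  swapped : modifyAt (length (A ++ x ∷ B)) (λ _ → minus1 x) (A ++ y ∷ B ++ y ∷ C) ≡ A ++ y ∷ B ++ minus1 x ∷ C
  swapped rewrite length-replace A x y B | reassoc y | modifyAt-++-∷ (A ++ y ∷ B) y C (λ _ → minus1 x) =
    ++-assoc A (y ∷ B) (minus1 x ∷ C)

take-++-length : ∀ {A : Set} (xs ys : List A) n → n ≡ length xs → take n (xs ++ ys) ≡ xs
take-++-length []       ys zero    refl = refl
take-++-length (x ∷ xs) ys (suc n) e    = cong (x ∷_) (take-++-length xs ys n (suc-injective e))

drop-++-length : ∀ {A : Set} (xs ys : List A) n → n ≡ length xs → drop n (xs ++ ys) ≡ ys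
drop-++-length []       ys zero    refl = refl
drop-++-length (x ∷ xs) ys (suc n) e    = drop-++-length xs ys n (suc-injective e)

refill-revrow : ∀ T T′ → SameShape T T′ → refill T (revrow T′) ≡ T′
refill-revrow []      []        _ = refl
refill-revrow (r ∷ T) (r′ ∷ T′) (r≡ , same)
  rewrite take-++-length (reverse r′) (revrow T′) (length r) (trans r≡ (sym (length-reverse r′)))
        | drop-++-length (reverse r′) (revrow T′) (length r) (trans r≡ (sym (length-reverse r′)))
        | reverse-involutive r′ | refill-revrow T T′ same = refl

-- x is the first 2 and y the first 1 of the reading word; e₁ replaces x by y and y by x − 1.
E1Related : Tab → Tab → Set
E1Related T T′ = Σ (List PN × List PN × List PN × PN × PN) λ where
  (A , B , C , x , y) → (revrow T ≡ A ++ x ∷ B ++ y ∷ C) × (revrow T′ ≡ A ++ y ∷ B ++ minus1 x ∷ C)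
                        × (val x ≡ 2) × (val y ≡ 1) × All NotOneOrTwo A × All NotOne B × SameShape T T′

e1T-E1Related : ∀ T T′ → E1Related T T′ → e1T T ≡ just T′
e1T-E1Related T T′ ((A , B , C , x , y) , e , e′ , x≡2 , y≡1 , notA , notB , same)
  rewrite e | e1w-++ A B C x y notA notB x≡2 y≡1 | sym e′ = cong just (refill-revrow T T′ same)

≥3⇒NotOneOrTwo : ∀ y → 3 ≤ val y → NotOneOrTwo y
≥3⇒NotOneOrTwo y y≥3 = (λ y≡1 → 3≰1 (subst (3 ≤_) y≡1 y≥3)) , (λ y≡2 → 3≰2 (subst (3 ≤_) y≡2 y≥3))
  where
  3≰1 : ¬ 3 ≤ 1
  3≰1 (s≤s ())
  3≰2 : ¬ 3 ≤ 2
  3≰2 (s≤s (s≤s ()))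

unprimed-NotOneOrTwo : ∀ l → All (3 ≤_) l → All NotOneOrTwo (reverse (map unprimed l))
unprimed-NotOneOrTwo l al = All-reverse (map unprimed l) (map⁺ (All.map (λ {x} → ≥3⇒NotOneOrTwo (unprimed x)) al))

reverse-unprimed-∷ : ∀ x l (R : List PN) → reverse (map unprimed (x ∷ l)) ++ R ≡ reverse (map unprimed l) ++ unprimed x ∷ R
reverse-unprimed-∷ x l R rewrite unfold-reverse (unprimed x) (map unprimed l) = ++-assoc (reverse (map unprimed l)) [ unprimed x ] R

reverse-unprimed-∷ʳ : ∀ d x → reverse (map unprimed (d ++ [ x ])) ≡ unprimed x ∷ reverse (map unprimed d)
reverse-unprimed-∷ʳ d x rewrite map-++ unprimed d [ x ] | reverse-++ (map unprimed d) [ unprimed x ] = refl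

revrow-row-∷ : ∀ d m p v T →
  revrow (row d m p v ∷ T) ≡ reverse (map unprimed v) ++ (m ^ p) ∷ reverse (map unprimed d) ++ revrow T
revrow-row-∷ d m p v T = trans (cong (_++ revrow T) (reverse-row d m p v)) (++-assoc (reverse (map unprimed v)) _ (revrow T))

-- The inserted 2 is read immediately before the middle 1.
E1Related-adjacent : ∀ D ys t T → All (3 ≤_) ys → E1Related (row D 1 t (2 ∷ ys) ∷ T) (row (D ++ [ 1 ]) 1 t ys ∷ T)
E1Related-adjacent D ys t T ys≥3 =
  (reverse (map unprimed ys) , [] , reverse (map unprimed D) ++ revrow T , 2 ^ false , 1 ^ t)
  , trans (revrow-row-∷ D 1 t (2 ∷ ys) T) (reverse-unprimed-∷ 2 ys _)
  , trans (revrow-row-∷ (D ++ [ 1 ]) 1 t ys T)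
          (cong (λ l → reverse (map unprimed ys) ++ (1 ^ t) ∷ l ++ revrow T) (reverse-unprimed-∷ʳ D 1))
  , refl , refl , unprimed-NotOneOrTwo ys ys≥3 , []
  , length-row-cong D 1 t (2 ∷ ys) (D ++ [ 1 ]) 1 t ys
      (trans (length-++-cong D (1 ∷ 2 ∷ ys) (1 ∷ 1 ∷ ys) refl) (cong length (sym (++-assoc D [ 1 ] (1 ∷ ys)))))
  , SameShape-refl T

E1Related-row : ∀ D ys s t R R′ → All (2 ≤_) D → All (3 ≤_) ys → DifferAtFirstOne t s R R′ →
  E1Related (row D 2 s ys ∷ R) (row D 1 t ys ∷ R′)
E1Related-row D ys s t R R′ D≥2 ys≥3 ((B , C) , e , e′ , notB , same) =
  (reverse (map unprimed ys) , reverse (map unprimed D) ++ B , C , 2 ^ s , 1 ^ t)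
  , trans (revrow-row-∷ D 2 s ys R) (trans (cong (λ l → A ++ (2 ^ s) ∷ reverse (map unprimed D) ++ l) e) (reassoc (2 ^ s) _))
  , trans (revrow-row-∷ D 1 t ys R′) (trans (cong (λ l → A ++ (1 ^ t) ∷ reverse (map unprimed D) ++ l) e′) (reassoc (1 ^ t) _))
  , refl , refl , unprimed-NotOneOrTwo ys ys≥3 , ++⁺ (unprimed-NotOne D D≥2) notB
  , length-row-cong D 2 s ys D 1 t ys (length-replace D 2 1 ys) , same
  where
  A = reverse (map unprimed ys)
  reassoc : ∀ z u → A ++ z ∷ reverse (map unprimed D) ++ B ++ u ≡ A ++ z ∷ (reverse (map unprimed D) ++ B) ++ u
  reassoc z u = cong (λ l → A ++ z ∷ l) (sym (++-assoc (reverse (map unprimed D)) B u))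

Increasing⇒All≥3 : ∀ y ys → 2 ≤ y → Increasing (y ∷ ys) → All (3 ≤_) ys
Increasing⇒All≥3 y ys y≥2 s = All.map (≤-<-trans y≥2) (Increasing⇒All>head y ys s)

e1-oneInFirstRow-noIncreasing : ∀ d s t rest → Hook d 1 [] →
  InsertionsRelated E1Related (2 ^ s) (row d 1 t [] ∷ rest) (1 ^ t) (row d 1 s [] ∷ rest)
e1-oneInFirstRow-noIncreasing d s t rest (w , si , ps) =
  (_ , _ , parityOf s) , decIns-halt _ d 1 t [] rest _ _ stepA , decIns-halt _ d 1 s [] rest _ _ stepB
  , E1Related-adjacent d [] t rest []
  where
  hookA : Hook d 1 [ 2 ]
  hookA = w , (≤-refl , tt) , subst Positive (++-assoc d [ 1 ] [ 2 ]) (++⁺ ps (s≤s z≤n ∷ []))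
  stepA : insRow (2 ^ s) (row d 1 t []) ≡ halt (row d 1 t [ 2 ]) (parityOf s)
  stepA = insRow-append-keepsMiddle d 1 t [] 2 s d 1 [ 2 ] (w , si , ps) (++-assoc d [ 1 ] [ 2 ]) hookA refl
  stepB : insRow (1 ^ t) (row d 1 s []) ≡ halt (row (d ++ [ 1 ]) 1 t []) (parityOf s)
  stepB = insRow-belowMiddle d 1 s 1 t (w , si , ps) ≤-refl ≤-refl

e1-oneInFirstRow-bumpMiddle : ∀ d y ys s t rest → Hook d 1 (y ∷ ys) → All HookRow rest →
  replaceFirst (λ x → x <ᵇ y) y (d ++ [ 1 ]) ≡ just (1 , d ++ [ y ]) → All (λ x → (x <ᵇ y) ≡ false) d →
  InsertionsRelated E1Related (2 ^ s) (row d 1 t (y ∷ ys) ∷ rest) (1 ^ t) (row d 1 s (y ∷ ys) ∷ rest)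
e1-oneInFirstRow-bumpMiddle d y ys s t rest hook hooks r₂ before with decIns-1 rest hooks t s
... | (R , R′ , π) , e , e′ , diff =
  (_ , _ , π) , decIns-bump _ d 1 t (y ∷ ys) rest _ _ R π (step 2 s t (s≤s z≤n) ≤-refl) e
              , decIns-bump _ d 1 s (y ∷ ys) rest _ _ R′ π (step 1 t s ≤-refl (s≤s z≤n)) e′
  , E1Related-row (d ++ [ y ]) ys s t R R′ D≥2 (Increasing⇒All≥3 y ys y≥2 (proj₂ (proj₁ (proj₂ hook)))) diff
  where
  y≥2 : 2 ≤ y
  y≥2 = proj₁ (proj₁ (proj₂ hook))
  D≥2 : All (2 ≤_) (d ++ [ y ])
  D≥2 = ++⁺ (All.map (λ y≤x → ≤-trans y≥2 (<ᵇ≡false⇒≥ y≤x)) before) (y≥2 ∷ [])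
  step : ∀ a q p → 1 ≤ a → a ≤ 2 → insRow (a ^ q) (row d 1 p (y ∷ ys)) ≡ bump (row (d ++ [ y ]) a q ys) (1 ^ p)
  step a q p 1≤a a≤2 = insRow-belowIncreasing d 1 p y ys 1 d [] a q hook refl r₂ before (<⇒<ᵇ≡true y≥2)
                         1≤a (≤-trans a≤2 y≥2) (All.map (≤-trans a≤2) D≥2)

e1-oneInFirstRow-bumpDecreasing : ∀ e₁ c e₂ y ys s t rest → Hook (e₁ ++ c ∷ e₂) 1 (y ∷ ys) → All HookRow rest →
  (e₁ ++ c ∷ e₂) ++ [ 1 ] ≡ e₁ ++ c ∷ e₂ ++ [ 1 ] →
  replaceFirst (λ x → x <ᵇ y) y ((e₁ ++ c ∷ e₂) ++ [ 1 ]) ≡ just (c , e₁ ++ y ∷ e₂ ++ [ 1 ]) →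
  All (λ x → (x <ᵇ y) ≡ false) e₁ → (c <ᵇ y) ≡ true →
  InsertionsRelated E1Related (2 ^ s) (row (e₁ ++ c ∷ e₂) 1 t (y ∷ ys) ∷ rest) (1 ^ t) (row (e₁ ++ c ∷ e₂) 1 s (y ∷ ys) ∷ rest)
e1-oneInFirstRow-bumpDecreasing e₁ c e₂ y ys s t rest hook@(w , si , ps) hooks dm≡ r₂ before c<y
  with All-∷-split (e₁ ++ c ∷ e₂) 1 (y ∷ ys) ps
... | dmPos , vPos with decIns-succeeds (λ _ → ⊤) rest hooks (c ^ s) (All-middle e₁ c (e₂ ++ [ 1 ]) (subst Positive dm≡ dmPos)) tt
... | (T , π) , eT =
  (_ , _ , π) , decIns-bump _ d 1 t (y ∷ ys) rest _ _ T π stepA eT , decIns-bump _ d 1 s (y ∷ ys) rest _ _ T π stepB eT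
  , E1Related-adjacent D ys t T (Increasing⇒All≥3 y ys y≥2 (proj₂ si))
  where
  d = e₁ ++ c ∷ e₂
  D = e₁ ++ y ∷ e₂
  y≥2 : 2 ≤ y
  y≥2 = proj₁ si
  D1≡ : D ++ [ 1 ] ≡ e₁ ++ y ∷ e₂ ++ [ 1 ]
  D1≡ = ++-assoc e₁ (y ∷ e₂) [ 1 ]
  D1Pos : Positive (e₁ ++ y ∷ e₂ ++ [ 1 ])
  D1Pos = All-replace e₁ c (e₂ ++ [ 1 ]) y (subst Positive dm≡ dmPos) (All.head vPos)
  hookA : Hook D 1 (2 ∷ ys)
  hookA = subst WeaklyDecreasing (sym D1≡)
            (WeaklyDecreasing-replace e₁ c (e₂ ++ [ 1 ]) y (subst WeaklyDecreasing dm≡ w) before (<⇒≤ (<ᵇ≡true⇒< c<y)))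
        , (≤-refl , Increasing-lowerHead ys y≥2 (proj₂ si))
        , subst Positive (++-assoc D [ 1 ] (2 ∷ ys)) (++⁺ (subst Positive (sym D1≡) D1Pos) (s≤s z≤n ∷ All.tail vPos))
  stepA : insRow (2 ^ s) (row d 1 t (y ∷ ys)) ≡ bump (row D 1 t (2 ∷ ys)) (c ^ s)
  stepA = insRow-bump-keepsMiddle d 1 t (y ∷ ys) 2 s y (2 ∷ ys) c (e₁ ++ y ∷ e₂ ++ [ 1 ]) D 1 (2 ∷ ys) hook
            (hookSplit-∷ʳ-below d 1 y ys 2 w (proj₁ si) y≥2) (replaceFirst-head (λ x → 2 ≤ᵇ x) 2 y ys (≤⇒≤ᵇ≡true y≥2)) r₂
            (trans (cong (_++ 2 ∷ ys) (sym D1≡)) (++-assoc D [ 1 ] (2 ∷ ys))) hookA (length-replace e₁ c y e₂)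
  stepB : insRow (1 ^ t) (row d 1 s (y ∷ ys)) ≡ bump (row (D ++ [ 1 ]) 1 t ys) (c ^ s)
  stepB = trans (insRow-belowIncreasing d 1 s y ys c e₁ (e₂ ++ [ 1 ]) 1 t hook dm≡ r₂ before c<y ≤-refl (All.head vPos) D1Pos)
                (cong (λ D′ → bump (row D′ 1 t ys) (c ^ s)) (sym D1≡))

e1-oneInFirstRow : ∀ d v s t rest → Hook d 1 v → All HookRow rest →
  InsertionsRelated E1Related (2 ^ s) (row d 1 t v ∷ rest) (1 ^ t) (row d 1 s v ∷ rest)
e1-oneInFirstRow d []       s t rest hook hooks = e1-oneInFirstRow-noIncreasing d s t rest hook
e1-oneInFirstRow d (y ∷ ys) s t rest hook hooks with bumpSite d 1 y (proj₁ (proj₁ (proj₂ hook)))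
... | (c , e₁ , e₂) , dm≡ , r₂ , before , c<y with ∷ʳ-split d 1 e₁ c e₂ dm≡
... | inj₁ (refl , refl , refl) = e1-oneInFirstRow-bumpMiddle d y ys s t rest hook hooks r₂ before
... | inj₂ (e₂′ , refl , refl) = e1-oneInFirstRow-bumpDecreasing e₁ c e₂′ y ys s t rest hook hooks dm≡ r₂ before c<y

e1-oneBelowFirstRow : ∀ r₀ rows₀ → HookRowWith (2 ≤_) r₀ → All (HookRowWith (2 ≤_)) rows₀ →
  ∀ d v s t rest → Hook d 1 v → All HookRow rest →
  InsertionsRelated E1Related (2 ^ s) (r₀ ∷ rows₀ ++ row d 1 t v ∷ rest) (1 ^ t) (r₀ ∷ rows₀ ++ row d 1 s v ∷ rest)
e1-oneBelowFirstRow _ rows₀ ((d₀ , m₀ , p₀ , []) , refl , hook₀ , ≥2₀) hooks₀ d v s t rest hook hooks =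
  (_ , _ , parityOf p₀) , decIns-halt _ d₀ m₀ p₀ [] _ _ _ (step 2 s (s≤s z≤n) ≤-refl)
                        , decIns-halt _ d₀ m₀ p₀ [] _ _ _ (step 1 t ≤-refl (s≤s z≤n))
  , E1Related-row (d₀ ++ [ m₀ ]) [] s t _ _ ≥2₀ []
      (DifferAtFirstOne-++ rows₀ hooks₀ (DifferAtFirstOne-row d t s v rest (Increasing⇒All>head 1 v (proj₁ (proj₂ hook)))))
  where
  step : ∀ a q → 1 ≤ a → a ≤ 2 → insRow (a ^ q) (row d₀ m₀ p₀ []) ≡ halt (row (d₀ ++ [ m₀ ]) a q []) (parityOf p₀)
  step a q 1≤a a≤2 = insRow-belowMiddle d₀ m₀ p₀ a q hook₀ 1≤a (≤-trans a≤2 (All-middle d₀ m₀ [] ≥2₀))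
e1-oneBelowFirstRow _ rows₀ ((d₀ , m₀ , p₀ , y₀ ∷ ys₀) , refl , hook₀ , ≥2₀) hooks₀ d v s t rest hook hooks
  with All-∷-split d₀ m₀ (y₀ ∷ ys₀) ≥2₀ | bumpSite d₀ m₀ y₀ (proj₁ (proj₁ (proj₂ hook₀)))
... | dm≥2 , y₀≥2 ∷ _ | (c , e₁ , e₂) , dm≡ , r₂ , before , c<y₀
  with decIns-≥2 rows₀ hooks₀ d v t s rest hook hooks c p₀ (All-middle e₁ c e₂ (subst (All (2 ≤_)) dm≡ dm≥2))
... | (R , R′ , π) , e , e′ , diff =
  (_ , _ , π) , decIns-bump _ d₀ m₀ p₀ (y₀ ∷ ys₀) _ _ _ R π (step 2 s (s≤s z≤n) ≤-refl) e
              , decIns-bump _ d₀ m₀ p₀ (y₀ ∷ ys₀) _ _ _ R′ π (step 1 t ≤-refl (s≤s z≤n)) e′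
  , E1Related-row D ys₀ s t R R′ D≥2 (Increasing⇒All≥3 y₀ ys₀ y₀≥2 (proj₂ (proj₁ (proj₂ hook₀)))) diff
  where
  D = e₁ ++ y₀ ∷ e₂
  D≥2 : All (2 ≤_) D
  D≥2 = All-replace e₁ c e₂ y₀ (subst (All (2 ≤_)) dm≡ dm≥2) y₀≥2
  step : ∀ a q → 1 ≤ a → a ≤ 2 → insRow (a ^ q) (row d₀ m₀ p₀ (y₀ ∷ ys₀)) ≡ bump (row D a q ys₀) (c ^ p₀)
  step a q 1≤a a≤2 = insRow-belowIncreasing d₀ m₀ p₀ y₀ ys₀ c e₁ e₂ a q hook₀ dm≡ r₂ before c<y₀
                       1≤a (≤-trans a≤2 y₀≥2) (All.map (≤-trans a≤2) D≥2)

AllRows⇒HookRows : ∀ P → AllRows P → All HookRow P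
AllRows⇒HookRows []       _            = []
AllRows⇒HookRows (r ∷ rs) (prim , prims) with PrimedRow⇒row r prim
... | (d , m , p , v) , r≡ , hook = ((d , m , p , v) , r≡ , hook , All.universal (λ _ → tt) _) ∷ AllRows⇒HookRows rs prims

Hook-≥2 : ∀ d m v → Hook d m v → m ≢ 1 → All (2 ≤_) (d ++ m ∷ v)
Hook-≥2 d m v (w , s , ps) m≢1 =
  ++⁺ (++⁻ˡ d (All.map (≤-trans m≥2) (WeaklyDecreasing⇒All≥last d m w)))
      (m≥2 ∷ All.map (λ m<x → ≤-trans m≥2 (<⇒≤ m<x)) (Increasing⇒All>head m v s))
  where
  m≥2 : 2 ≤ m
  m≥2 = ≤∧≢⇒< (All-middle d m v ps) (m≢1 ∘ sym)

prefix-beforeFirstOne : ∀ (pre : List PN) o post W E → pre ++ o ∷ post ≡ W ++ E → All NotOne W → val o ≡ 1 →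
  Σ (List PN) λ pre₂ → (pre ≡ W ++ pre₂) × (E ≡ pre₂ ++ o ∷ post)
prefix-beforeFirstOne pre       o post []      E eq _           _   = pre , refl , sym eq
prefix-beforeFirstOne []        o post (w ∷ W) E eq (w≢1 ∷ _)   o≡1 = contradiction (trans (cong val (sym (∷-injectiveˡ eq))) o≡1) w≢1
prefix-beforeFirstOne (z ∷ pre) o post (w ∷ W) E eq (_ ∷ notW) o≡1 with ∷-injective eq
... | refl , eq′ with prefix-beforeFirstOne pre o post W E eq′ notW o≡1
...   | pre₂ , pre≡ , E≡ = pre₂ , cong (z ∷_) pre≡ , E≡

FirstOneLocation : Tab → List PN → PN → List PN → Set
FirstOneLocation P pre o post = Σ (Tab × List ℕ × List ℕ × Tab × Bool) λ where
  (rows₀ , d , v , rest , t) → (P ≡ rows₀ ++ row d 1 t v ∷ rest) × (o ≡ 1 ^ t)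
    × (pre ≡ revrow rows₀ ++ reverse (map unprimed v)) × (post ≡ reverse (map unprimed d) ++ revrow rest)
    × All (HookRowWith (2 ≤_)) rows₀ × Hook d 1 v × All HookRow rest

locateFirstOne : ∀ P → All HookRow P → ∀ pre o post → revrow P ≡ pre ++ o ∷ post → All NotOne pre → val o ≡ 1 →
  FirstOneLocation P pre o post
locateFirstOne [] [] []      o post () _ _
locateFirstOne [] [] (_ ∷ _) o post () _ _
locateFirstOne (_ ∷ P) (((d , m , p , v) , refl , hook , _) ∷ hooks) pre o post eq notPre o≡1 with m ≟ 1
... | yes refl with prefix-beforeFirstOne pre o post (reverse (map unprimed v)) ((1 ^ p) ∷ reverse (map unprimed d) ++ revrow P)
                     (trans (sym eq) (revrow-row-∷ d 1 p v P))
                     (unprimed-NotOne v (Increasing⇒All>head 1 v (proj₁ (proj₂ hook)))) o≡1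
...   | [] , pre≡ , refl = ([] , d , v , P , p) , refl , refl , trans pre≡ (++-identityʳ _) , refl , [] , hook , hooks
...   | z ∷ pre₂ , pre≡ , E≡ with ∷-injective E≡
...     | refl , _ with ++⁻ʳ (reverse (map unprimed v)) (subst (All NotOne) pre≡ notPre)
...       | z≢1 ∷ _ = contradiction refl z≢1
locateFirstOne (_ ∷ P) (((d , m , p , v) , refl , hook , _) ∷ hooks) pre o post eq notPre o≡1 | no m≢1
  with prefix-beforeFirstOne pre o post (reverse (row d m p v)) (revrow P) (sym eq) (row-NotOne d m p v (Hook-≥2 d m v hook m≢1)) o≡1
... | pre₂ , pre≡ , E≡ with locateFirstOne P hooks pre₂ o post E≡ (++⁻ʳ (reverse (row d m p v)) (subst (All NotOne) pre≡ notPre)) o≡1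
...   | (rows₀ , d′ , v′ , rest , t) , P≡ , o≡ , pre₂≡ , post≡ , hooks₀ , hook′ , hooks′ =
  (row d m p v ∷ rows₀ , d′ , v′ , rest , t) , cong (row d m p v ∷_) P≡ , o≡
  , trans pre≡ (trans (cong (reverse (row d m p v) ++_) pre₂≡) (sym (++-assoc (reverse (row d m p v)) (revrow rows₀) _)))
  , post≡ , ((d , m , p , v) , refl , hook , Hook-≥2 d m v hook m≢1) ∷ hooks₀ , hook′ , hooks′

revrow-++ : ∀ {A : Set} (xs ys : List (List A)) → revrow (xs ++ ys) ≡ revrow xs ++ revrow ys
revrow-++ []       ys = refl
revrow-++ (x ∷ xs) ys rewrite revrow-++ xs ys = sym (++-assoc (reverse x) (revrow xs) (revrow ys))

revrow-location : ∀ rows₀ d v b rest → revrow (rows₀ ++ row d 1 b v ∷ rest)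
  ≡ (revrow rows₀ ++ reverse (map unprimed v)) ++ (1 ^ b) ∷ (reverse (map unprimed d) ++ revrow rest)
revrow-location rows₀ d v b rest =
  trans (revrow-++ rows₀ (row d 1 b v ∷ rest))
        (trans (cong (revrow rows₀ ++_) (revrow-row-∷ d 1 b v rest)) (sym (++-assoc (revrow rows₀) _ _)))

e1-insertions : ∀ rows₀ d v s t rest → All (HookRowWith (2 ≤_)) rows₀ → Hook d 1 v → All HookRow rest →
  InsertionsRelated E1Related (2 ^ s) (rows₀ ++ row d 1 t v ∷ rest) (1 ^ t) (rows₀ ++ row d 1 s v ∷ rest)
e1-insertions []           d v s t rest []          hook hooks = e1-oneInFirstRow d v s t rest hook hooks
e1-insertions (r₀ ∷ rows₀) d v s t rest (h₀ ∷ hs₀) hook hooks = e1-oneBelowFirstRow r₀ rows₀ h₀ hs₀ d v s t rest hook hooks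

mainTheorem13 : (P : Tab) → IsPDT P →
    (pre post : List PN) (o : PN) →
    revrow P ≡ pre ++ (o ∷ post) → All (λ y → val y ≢ 1) pre → val o ≡ 1 →
    (bx : Bool) →
    Σ (Tab × Tab × Parity) λ where
      (T , T′ , π) → decIns (2 ^ bx) P ≡ just (T , π)
                   × decIns o (refill P (pre ++ ((1 ^ bx) ∷ post))) ≡ just (T′ , π)
                   × e1T T ≡ just T′
mainTheorem13 P (_ , rows , _) pre post o eq notPre o≡1 bx
  with locateFirstOne P (AllRows⇒HookRows P rows) pre o post eq notPre o≡1
... | (rows₀ , d , v , rest , t) , refl , refl , refl , refl , hooks₀ , hook , hooks
  with e1-insertions rows₀ d v bx t rest hooks₀ hook hooks
...   | (T , T′ , π) , insX , insX̃ , related =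
  (T , T′ , π) , insX , trans (cong (decIns (1 ^ t)) refilled) insX̃ , e1T-E1Related T T′ related
  where
  P̃ = rows₀ ++ row d 1 bx v ∷ rest
  refilled : refill (rows₀ ++ row d 1 t v ∷ rest)
                    ((revrow rows₀ ++ reverse (map unprimed v)) ++ (1 ^ bx) ∷ (reverse (map unprimed d) ++ revrow rest)) ≡ P̃
  refilled = trans (cong (refill _) (sym (revrow-location rows₀ d v bx rest)))
                   (refill-revrow _ P̃ (SameShape-++ rows₀ (length-row-cong d 1 t v d 1 bx v refl , SameShape-refl rest)))
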